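{- For $n\ge 3$, let $G_n=C_n\square P_2$ be the prism graph. Then \[ \zeta(G_n)= \begin{cases} 9, & n=3,\\ 4, & n\equiv 0\pmod{4},\\ 2n, & n\equiv 1,3\pmod{4},\\ 51, & n=6,\\ n(n+2), & n\equiv 2\pmod{4},\ n\ge 10. \end{cases} \]
   Context: For $n\ge3$, the prism graph $G_n=C_n\square P_2$ has vertex set $\{(t,i),(b,i): i\in\mathbb{Z}_n\}$ (indices mod $n$), with edges joining $(t,i)$ to $(t,i\pm1)$ and to $(b,i)$, and $(b,i)$ to $(b,i\pm1)$ and to $(t,i)$. A set $S$ of vertices is dominating if every vertex is in $S$ or adjacent to a vertex of $S$. $\gamma(G)$ is the minimum size of a dominating set, and the dominion $\zeta(G)$ is the number of dominating sets of size $\gamma(G)$, where the graph is labeled, so distinct vertex subsets are counted separately (even if related by rotation). -}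

module Defs where

open import Data.Nat using (ℕ; zero; suc; _+_; _%_; _≡ᵇ_; _<ᵇ_)
open import Data.Bool using (Bool; true; false; _∧_; _∨_; not)
open import Data.Fin using (Fin; toℕ)
open import Data.List using (List; []; _∷_; _++_; filter; length; foldr; map; allFin)
open import Data.Bool.ListAction using (any; all)
open import Data.Product using (_×_; _,_)
open import Data.Bool.Properties using (T?)

-- Vertices of the prism G_n = C_n □ P_2: (true , i) is (t,i), (false , i) is (b,i).
Vertex : ℕ → Set
Vertex n = Bool × Fin n

vertices : (n : ℕ) → List (Vertex n)
vertices n = map (true ,_) (allFin n) ++ map (false ,_) (allFin n)

_==B_ : Bool → Bool → Bool
true ==B b = b
false ==B b = not b

cycAdj : (n : ℕ) → Fin n → Fin n → Bool
cycAdj zero _ _ = false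
cycAdj (suc m) i j =
  ((suc (toℕ i) % suc m) ≡ᵇ toℕ j) ∨ ((suc (toℕ j) % suc m) ≡ᵇ toℕ i)

adj : (n : ℕ) → Vertex n → Vertex n → Bool
adj n (s , i) (s' , j) =
  ((s ==B s') ∧ cycAdj n i j) ∨ (not (s ==B s') ∧ (toℕ i ≡ᵇ toℕ j))

eqV : (n : ℕ) → Vertex n → Vertex n → Bool
eqV n (s , i) (s' , j) = (s ==B s') ∧ (toℕ i ≡ᵇ toℕ j)

VSet : ℕ → Set
VSet n = Vertex n → Bool

subsetsOf : ∀ {n} → List (Vertex n) → List (VSet n)
subsetsOf {n} [] = (λ _ → false) ∷ []
subsetsOf {n} (v ∷ vs) =
  let rest = subsetsOf vs in
  rest ++ map (λ S w → eqV n v w ∨ S w) rest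

allSubsets : (n : ℕ) → List (VSet n)
allSubsets n = subsetsOf (vertices n)

size : (n : ℕ) → VSet n → ℕ
size n S = length (filter (λ v → T? (S v)) (vertices n))

isDominating : (n : ℕ) → VSet n → Bool
isDominating n S = all (λ v → S v ∨ any (λ u → S u ∧ adj n u v) (vertices n)) (vertices n)

dominatingSets : (n : ℕ) → List (VSet n)
dominatingSets n = filter (λ S → T? (isDominating n S)) (allSubsets n)

minimumWith : ℕ → List ℕ → ℕ
minimumWith d [] = d
minimumWith d (x ∷ xs) = foldr Data.Nat._⊓_ x xs

γ : ℕ → ℕ
γ n = minimumWith 0 (map (size n) (dominatingSets n))

ζ : ℕ → ℕ
ζ n = length (filter (λ S → T? (size n S ≡ᵇ γ n)) (dominatingSets n))

{-# OPTIONS --safe #-}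
-- Record a vertex set of the prism rung by rung: rung i carries the pair of bits
-- ((t,i) ∈ S, (b,i) ∈ S), and S dominates exactly when every rung is dominated by itself and its
-- two cyclic neighbours, a condition on consecutive triples of rungs. The pair (γ, ζ) is therefore a
-- sum over cyclic words in the (min,+) semiring with multiplicities, which a transfer matrix indexed
-- by pairs of rungs computes. From 11 steps on, its entries repeat with period 4, the weight growing by
-- 2 and the multiplicity being a quadratic polynomial in the number of periods; this is verified once
-- on symbolic entries, giving ζ for all n ≥ 13, while 3 ≤ n ≤ 12 is computed directly.
module Submission where

open import Defs
open import Data.Nat using (ℕ; _≤_; _*_; _+_; _%_)
open import Relation.Binary.PropositionalEquality using (_≡_)
open import Data.Product using (_×_)

open import Algebra.Bundles using (CommutativeSemigroup; CommutativeMonoid)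
open import Algebra.Core using (Op₂)
open import Algebra.Structures using (IsCommutativeSemigroup; IsCommutativeMonoid)
open import Data.Bool using (Bool; true; false; _∧_; _∨_; if_then_else_)
open import Data.Bool.ListAction using (all; any)
open import Data.Bool.Properties
  using (T?; ∧-isCommutativeMonoid; ∨-isCommutativeMonoid; ∧-zeroʳ; ∧-identityʳ; ∨-identityʳ; ∨-assoc;
         ∧-distribˡ-∨)
open import Data.Fin as Fin using (Fin; toℕ)
open import Data.Fin.Properties using (toℕ<n)
open import Data.List
  using (List; []; _∷_; _++_; _∷ʳ_; map; foldr; filter; filterᵇ; length; take; zip; upTo; applyUpTo;
         tabulate; allFin; cartesianProduct; cartesianProductWith)
open import Data.List.Membership.Propositional using (_∈_)
open import Data.List.Membership.Propositional.Properties using (∈-upTo⁻)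
open import Data.List.Properties
  using (map-∘; map-cong; map-++; map-tabulate; map-upTo; upTo-∷ʳ; ++-identityʳ; length-map; length-tabulate;
         length-++; length-zipWith)
open import Data.List.Relation.Unary.Any using (here; there)
open import Data.Nat using (zero; suc; _∸_; _<_; _⊓_; _/_; _≡ᵇ_; s≤s; z≤n)
open import Data.Nat.Combinatorics using (_C_; nC1≡n; nCk+nC[k+1]≡[n+1]C[k+1])
open import Data.Nat.DivMod
  using (%-distribˡ-+; m%n%n≡m%n; [m+n]%n≡m%n; m<n⇒m%n≡m; m%n<n; n%n≡0; m≡m%n+[m/n]*n)
open import Data.Nat.Properties
  using (_≟_; _<?_; +-assoc; +-comm; +-suc; suc-injective; +-isCommutativeSemigroup;
         +-commutativeSemigroup; +-0-isCommutativeMonoid; <-cmp; <⇒≤; >⇒≢; <-≤-trans; ≤-trans; ≤-pred;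
         ≮⇒≥; n≤1+n; m≤m+n; m+n∸n≡m; m+[n∸m]≡n; +-cancelˡ-<; *-cancelʳ-<; +-monoˡ-≤; m⊓n≤m; m⊓n≤n;
         m≤n⇒m⊓n≡m; m≥n⇒m⊓n≡n; ⊓-idem)
open import Data.Nat.Solver using (module +-*-Solver)
open import Data.Product using (_,_; proj₂; uncurry; ∃-syntax)
open import Data.Product.Properties using (,-injective)
open import Function using (_∘_; _∘′_; id; mk⇔)
open import Level using (0ℓ)
open import Relation.Binary.Definitions using (DecidableEquality; Tri; tri<; tri≈; tri>)
open import Relation.Binary.PropositionalEquality
  using (_≢_; refl; sym; trans; cong; cong₂; subst; subst₂; isEquivalence; module ≡-Reasoning)
open import Relation.Nullary.Decidable using (yes; no; map′; _×-dec_; from-yes; dec-true; dec-false; does-⇔)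

open ≡-Reasoning
open +-*-Solver using (solve; _:=_; _:+_; _:*_; con)

lookupOr : {A : Set} → A → List A → ℕ → A
lookupOr d []       _       = d
lookupOr d (x ∷ xs) zero    = x
lookupOr d (x ∷ xs) (suc i) = lookupOr d xs i

lookupOr-++ˡ : {A : Set} {d : A} (xs ys : List A) → ∀ {i} → i < length xs →
               lookupOr d (xs ++ ys) i ≡ lookupOr d xs i
lookupOr-++ˡ (x ∷ xs) ys {zero}  _         = refl
lookupOr-++ˡ (x ∷ xs) ys {suc i} (s≤s i<n) = lookupOr-++ˡ xs ys i<n

lookupOr-++ʳ : {A : Set} {d : A} (xs ys : List A) → ∀ i →
               lookupOr d (xs ++ ys) (length xs + i) ≡ lookupOr d ys i
lookupOr-++ʳ []       ys i = refl
lookupOr-++ʳ (x ∷ xs) ys i = lookupOr-++ʳ xs ys i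

lookupOr-zip : {A B : Set} {a : A} {b : B} (xs : List A) (ys : List B) → length xs ≡ length ys →
               ∀ i → lookupOr (a , b) (zip xs ys) i ≡ (lookupOr a xs i , lookupOr b ys i)
lookupOr-zip []       []       _   i       = refl
lookupOr-zip (x ∷ xs) (y ∷ ys) _   zero    = refl
lookupOr-zip (x ∷ xs) (y ∷ ys) eq  (suc i) = lookupOr-zip xs ys (suc-injective eq) i

words : {X : Set} → List X → ℕ → List (List X)
words xs zero    = [] ∷ []
words xs (suc n) = cartesianProductWith _∷_ xs (words xs n)

map-toℕ-allFin : ∀ n → map toℕ (allFin n) ≡ upTo n
map-toℕ-allFin zero    = refl
map-toℕ-allFin (suc n) = cong (0 ∷_) (begin
  map toℕ (tabulate Fin.suc)       ≡⟨ map-tabulate Fin.suc toℕ ⟩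
  tabulate (suc ∘ toℕ)             ≡⟨ map-tabulate id (suc ∘ toℕ) ⟨
  map (suc ∘ toℕ) (allFin n)       ≡⟨ map-∘ (allFin n) ⟩
  map suc (map toℕ (allFin n))     ≡⟨ cong (map suc) (map-toℕ-allFin n) ⟩
  map suc (upTo n)                 ≡⟨ map-upTo suc n ⟩
  applyUpTo suc n                  ∎)

cong₃ : {A B C D : Set} (f : A → B → C → D) → ∀ {x x′ y y′ z z′} →
        x ≡ x′ → y ≡ y′ → z ≡ z′ → f x y z ≡ f x′ y′ z′
cong₃ f refl refl refl = refl

-- Sums over lists in a commutative monoid

module BigOp {A : Set} (_∙_ : Op₂ A) (ε : A) where

  infix  5 ⨁

  ⨁ : {X : Set} → List X → (X → A) → A
  ⨁ xs f = foldr _∙_ ε (map f xs)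

  syntax ⨁ xs (λ x → e) = ⨁[ x ← xs ] e

  module _ {X : Set} where

    ⨁-cong : (xs : List X) {f g : X → A} → (∀ x → f x ≡ g x) → ⨁ xs f ≡ ⨁ xs g
    ⨁-cong xs f≗g = cong (foldr _∙_ ε) (map-cong f≗g xs)

    ⨁-cong-∈ : (xs : List X) {f g : X → A} → (∀ {x} → x ∈ xs → f x ≡ g x) → ⨁ xs f ≡ ⨁ xs g
    ⨁-cong-∈ []       f≗g = refl
    ⨁-cong-∈ (x ∷ xs) f≗g = cong₂ _∙_ (f≗g (here refl)) (⨁-cong-∈ xs (f≗g ∘ there))

  ⨁-map : {X Y : Set} (g : X → Y) (xs : List X) (f : Y → A) → ⨁ (map g xs) f ≡ ⨁ xs (f ∘ g)
  ⨁-map g xs f = cong (foldr _∙_ ε) (sym (map-∘ xs))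

  ⨁-allFin : ∀ n (f : ℕ → A) → ⨁[ i ← allFin n ] f (toℕ i) ≡ ⨁ (upTo n) f
  ⨁-allFin n f = trans (sym (⨁-map toℕ (allFin n) f)) (cong (λ is → ⨁ is f) (map-toℕ-allFin n))

module BigOpHomomorphism {A B : Set} {_∙_ : Op₂ A} {ε : A} {_◦_ : Op₂ B} {ι : B}
  (h : A → B) (h-ε : h ε ≡ ι) (h-∙ : ∀ x y → h (x ∙ y) ≡ h x ◦ h y) where

  open BigOp

  ⨁-hom : {X : Set} (xs : List X) (f : X → A) → h (⨁ _∙_ ε xs f) ≡ ⨁ _◦_ ι xs (h ∘ f)
  ⨁-hom []       f = h-ε
  ⨁-hom (x ∷ xs) f = trans (h-∙ (f x) _) (cong (h (f x) ◦_) (⨁-hom xs f))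

module BigOpProperties {A : Set} {_∙_ : Op₂ A} {ε : A} (isCM : IsCommutativeMonoid _≡_ _∙_ ε) where

  open IsCommutativeMonoid isCM using (assoc; comm; identityˡ; identityʳ; isCommutativeSemigroup)

  private
    commutativeSemigroup : CommutativeSemigroup 0ℓ 0ℓ
    commutativeSemigroup = record { isCommutativeSemigroup = isCommutativeSemigroup }

  open import Algebra.Properties.CommutativeSemigroup commutativeSemigroup using (interchange)
  open BigOp _∙_ ε public

  module _ {X : Set} where

    ⨁-++ : (xs ys : List X) (f : X → A) → ⨁ (xs ++ ys) f ≡ ⨁ xs f ∙ ⨁ ys f
    ⨁-++ []       ys f = sym (identityˡ _)
    ⨁-++ (x ∷ xs) ys f = trans (cong (f x ∙_) (⨁-++ xs ys f)) (sym (assoc (f x) _ _))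

    ⨁-filter : (p : X → Bool) (xs : List X) (f : X → A) →
               ⨁ (filter (T? ∘ p) xs) f ≡ ⨁[ x ← xs ] (if p x then f x else ε)
    ⨁-filter p []       f = refl
    ⨁-filter p (x ∷ xs) f with p x
    ... | true  = cong (f x ∙_) (⨁-filter p xs f)
    ... | false = trans (⨁-filter p xs f) (sym (identityˡ _))

    ⨁-ε : (xs : List X) → ⨁[ x ← xs ] ε ≡ ε
    ⨁-ε []       = refl
    ⨁-ε (x ∷ xs) = trans (cong (ε ∙_) (⨁-ε xs)) (identityˡ ε)

    ⨁-∙ : (xs : List X) (f g : X → A) → ⨁[ x ← xs ] (f x ∙ g x) ≡ ⨁ xs f ∙ ⨁ xs g
    ⨁-∙ []       f g = sym (identityˡ ε)
    ⨁-∙ (x ∷ xs) f g = trans (cong ((f x ∙ g x) ∙_) (⨁-∙ xs f g)) (interchange (f x) (g x) _ _)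

  ⨁-comm : {X Y : Set} (xs : List X) (ys : List Y) (f : X → Y → A) →
           ⨁[ x ← xs ] ⨁[ y ← ys ] f x y ≡ ⨁[ y ← ys ] ⨁[ x ← xs ] f x y
  ⨁-comm []       ys f = sym (⨁-ε ys)
  ⨁-comm (x ∷ xs) ys f =
    trans (cong (⨁ ys (f x) ∙_) (⨁-comm xs ys f)) (sym (⨁-∙ ys (f x) (λ y → ⨁[ x ← xs ] f x y)))

  ⨁-cartesianProductWith : {X Y Z : Set} (g : X → Y → Z) (xs : List X) (ys : List Y) (f : Z → A) →
    ⨁ (cartesianProductWith g xs ys) f ≡ ⨁[ x ← xs ] ⨁[ y ← ys ] f (g x y)
  ⨁-cartesianProductWith g []       ys f = refl
  ⨁-cartesianProductWith g (x ∷ xs) ys f = begin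
    ⨁ (map (g x) ys ++ cartesianProductWith g xs ys) f
      ≡⟨ ⨁-++ (map (g x) ys) _ f ⟩
    ⨁ (map (g x) ys) f ∙ ⨁ (cartesianProductWith g xs ys) f
      ≡⟨ cong₂ _∙_ (⨁-map (g x) ys f) (⨁-cartesianProductWith g xs ys f) ⟩
    (⨁[ y ← ys ] f (g x y)) ∙ (⨁[ x ← xs ] ⨁[ y ← ys ] f (g x y)) ∎

  ⨁-rotate : ∀ m (f : ℕ → A) → ⨁[ k ← upTo (suc m) ] f (suc k % suc m) ≡ ⨁ (upTo (suc m)) f
  ⨁-rotate m f = begin
    ⨁[ k ← upTo (suc m) ] f (suc k % suc m)
      ≡⟨ cong (λ ks → ⨁[ k ← ks ] f (suc k % suc m)) (upTo-∷ʳ m) ⟨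
    ⨁[ k ← upTo m ∷ʳ m ] f (suc k % suc m)
      ≡⟨ ⨁-++ (upTo m) (m ∷ []) _ ⟩
    (⨁[ k ← upTo m ] f (suc k % suc m)) ∙ (f (suc m % suc m) ∙ ε)
      ≡⟨ cong₂ _∙_ (⨁-cong-∈ (upTo m) (cong f ∘ m<n⇒m%n≡m ∘ s≤s ∘ ∈-upTo⁻))
                   (trans (identityʳ _) (cong f (n%n≡0 (suc m)))) ⟩
    (⨁[ k ← upTo m ] f (suc k)) ∙ f 0
      ≡⟨ comm _ (f 0) ⟩
    f 0 ∙ (⨁[ k ← upTo m ] f (suc k))
      ≡⟨ cong (f 0 ∙_) (⨁-map suc (upTo m) f) ⟨
    f 0 ∙ ⨁ (map suc (upTo m)) f
      ≡⟨ cong (λ ks → f 0 ∙ ⨁ ks f) (map-upTo suc m) ⟩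
    ⨁ (upTo (suc m)) f ∎

  ⨁-lookupOr : {X : Set} {d : X} (xs : List X) (f : X → A) →
               ⨁[ i ← upTo (length xs) ] f (lookupOr d xs i) ≡ ⨁ xs f
  ⨁-lookupOr         []       f = refl
  ⨁-lookupOr {d = d} (x ∷ xs) f = cong (f x ∙_) (begin
    ⨁[ i ← applyUpTo suc (length xs) ] f (lookupOr d (x ∷ xs) i)
      ≡⟨ cong (λ is → ⨁[ i ← is ] f (lookupOr d (x ∷ xs) i)) (map-upTo suc (length xs)) ⟨
    ⨁[ i ← map suc (upTo (length xs)) ] f (lookupOr d (x ∷ xs) i)
      ≡⟨ ⨁-map suc (upTo (length xs)) _ ⟩
    ⨁[ i ← upTo (length xs) ] f (lookupOr d xs i)
      ≡⟨ ⨁-lookupOr xs f ⟩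
    ⨁ xs f ∎)

  module _ {X : Set} (xs : List X) where

    ⨁-words-suc : ∀ n (f : List X → A) →
                  ⨁ (words xs (suc n)) f ≡ ⨁[ x ← xs ] ⨁[ w ← words xs n ] f (x ∷ w)
    ⨁-words-suc n = ⨁-cartesianProductWith _∷_ xs (words xs n)

    ⨁-words-cong : ∀ n {f g : List X → A} → (∀ w → length w ≡ n → f w ≡ g w) →
                   ⨁ (words xs n) f ≡ ⨁ (words xs n) g
    ⨁-words-cong zero    f≗g = cong (_∙ ε) (f≗g [] refl)
    ⨁-words-cong (suc n) {f} {g} f≗g = begin
      ⨁ (words xs (suc n)) f                     ≡⟨ ⨁-words-suc n f ⟩
      ⨁[ x ← xs ] ⨁[ w ← words xs n ] f (x ∷ w)
        ≡⟨ ⨁-cong xs (λ x → ⨁-words-cong n (λ w ∣w∣ → f≗g (x ∷ w) (cong suc ∣w∣))) ⟩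
      ⨁[ x ← xs ] ⨁[ w ← words xs n ] g (x ∷ w)  ≡⟨ ⨁-words-suc n g ⟨
      ⨁ (words xs (suc n)) g                     ∎

    ⨁-words-+ : ∀ m n (f : List X → A) →
                ⨁ (words xs (m + n)) f ≡ ⨁[ τ ← words xs m ] ⨁[ σ ← words xs n ] f (τ ++ σ)
    ⨁-words-+ zero    n f = sym (identityʳ _)
    ⨁-words-+ (suc m) n f = begin
      ⨁ (words xs (suc m + n)) f
        ≡⟨ ⨁-words-suc (m + n) f ⟩
      ⨁[ x ← xs ] ⨁[ w ← words xs (m + n) ] f (x ∷ w)
        ≡⟨ ⨁-cong xs (λ x → ⨁-words-+ m n (f ∘ (x ∷_))) ⟩
      ⨁[ x ← xs ] ⨁[ τ ← words xs m ] ⨁[ σ ← words xs n ] f (x ∷ τ ++ σ)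
        ≡⟨ ⨁-words-suc m (λ τ → ⨁[ σ ← words xs n ] f (τ ++ σ)) ⟨
      ⨁[ τ ← words xs (suc m) ] ⨁[ σ ← words xs n ] f (τ ++ σ) ∎

  ⨁-words-zip : {X Y : Set} (xs : List X) (ys : List Y) → ∀ n (f : List (X × Y) → A) →
    ⨁[ τ ← words xs n ] ⨁[ σ ← words ys n ] f (zip τ σ) ≡ ⨁ (words (cartesianProduct xs ys) n) f
  ⨁-words-zip xs ys zero    f = identityʳ _
  ⨁-words-zip xs ys (suc n) f = begin
    ⨁[ τ ← words xs (suc n) ] ⨁[ σ ← words ys (suc n) ] f (zip τ σ)
      ≡⟨ ⨁-words-suc xs n _ ⟩
    ⨁[ x ← xs ] ⨁[ τ ← words xs n ] ⨁[ σ ← words ys (suc n) ] f (zip (x ∷ τ) σ)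
      ≡⟨ ⨁-cong xs (λ x → ⨁-cong (words xs n) (λ τ → ⨁-words-suc ys n _)) ⟩
    ⨁[ x ← xs ] ⨁[ τ ← words xs n ] ⨁[ y ← ys ] ⨁[ σ ← words ys n ] f ((x , y) ∷ zip τ σ)
      ≡⟨ ⨁-cong xs (λ x → ⨁-comm (words xs n) ys _) ⟩
    ⨁[ x ← xs ] ⨁[ y ← ys ] ⨁[ τ ← words xs n ] ⨁[ σ ← words ys n ] f ((x , y) ∷ zip τ σ)
      ≡⟨ ⨁-cong xs (λ x → ⨁-cong ys (λ y → ⨁-words-zip xs ys n (f ∘ ((x , y) ∷_)))) ⟩
    ⨁[ x ← xs ] ⨁[ y ← ys ] ⨁[ w ← words (cartesianProduct xs ys) n ] f ((x , y) ∷ w)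
      ≡⟨ ⨁-cartesianProductWith _,_ xs ys _ ⟨
    ⨁[ c ← cartesianProduct xs ys ] ⨁[ w ← words (cartesianProduct xs ys) n ] f (c ∷ w)
      ≡⟨ ⨁-words-suc (cartesianProduct xs ys) n f ⟨
    ⨁ (words (cartesianProduct xs ys) (suc n)) f ∎

-- all and any of Data.Bool.ListAction are definitionally the big operators of ∧ and ∨.
module All = BigOpProperties ∧-isCommutativeMonoid
module Any = BigOpProperties ∨-isCommutativeMonoid
module Sum = BigOpProperties +-0-isCommutativeMonoid

indicator : Bool → ℕ
indicator b = if b then 1 else 0

indicator-≡ : ∀ {a b} → a ≡ b → indicator (a ≡ᵇ b) ≡ 1
indicator-≡ {a} {b} a≡b = cong indicator (dec-true (a ≟ b) a≡b)

indicator-≢ : ∀ {a b} → a ≢ b → indicator (a ≡ᵇ b) ≡ 0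
indicator-≢ {a} {b} a≢b = cong indicator (dec-false (a ≟ b) a≢b)

length≡⨁1 : {X : Set} (xs : List X) → length xs ≡ Sum.⨁[ _ ← xs ] 1
length≡⨁1 []       = refl
length≡⨁1 (x ∷ xs) = cong suc (length≡⨁1 xs)

length-filterᵇ : {X : Set} (p : X → Bool) (xs : List X) →
                 length (filterᵇ p xs) ≡ Sum.⨁[ x ← xs ] indicator (p x)
length-filterᵇ p xs = trans (length≡⨁1 (filterᵇ p xs)) (Sum.⨁-filter p xs (λ _ → 1))

-- The (min,+) semiring with multiplicities

-- best w c: least weight w, attained with multiplicity c; ∞ is the empty sum.
data MinCount (C : Set) : Set where
  ∞    : MinCount C
  best : ℕ → C → MinCount C

shift : {C : Set} → ℕ → MinCount C → MinCount C
shift w ∞          = ∞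
shift w (best a c) = best (w + a) c

mapCount : {C D : Set} → (C → D) → MinCount C → MinCount D
mapCount f ∞          = ∞
mapCount f (best a c) = best a (f c)

module MinCountOps {C : Set} (_+ᶜ_ : Op₂ C) where

  merge : ℕ → C → ℕ → C → MinCount C
  merge zero    c zero    d = best zero (c +ᶜ d)
  merge zero    c (suc b) d = best zero c
  merge (suc a) c zero    d = best zero d
  merge (suc a) c (suc b) d = shift 1 (merge a c b d)

  infixl 6 _⊕_

  _⊕_ : Op₂ (MinCount C)
  ∞        ⊕ y        = y
  best a c ⊕ ∞        = best a c
  best a c ⊕ best b d = merge a c b d

  ⊕-identityʳ : ∀ x → x ⊕ ∞ ≡ x
  ⊕-identityʳ ∞          = refl
  ⊕-identityʳ (best a c) = refl

  merge-< : ∀ {a b} c d → a < b → merge a c b d ≡ best a c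
  merge-< {zero}  {suc b} c d _         = refl
  merge-< {suc a} {suc b} c d (s≤s a<b) = cong (shift 1) (merge-< c d a<b)

  merge-> : ∀ {a b} c d → b < a → merge a c b d ≡ best b d
  merge-> {suc a} {zero}  c d _         = refl
  merge-> {suc a} {suc b} c d (s≤s b<a) = cong (shift 1) (merge-> c d b<a)

  merge-≡ : ∀ a c d → merge a c a d ≡ best a (c +ᶜ d)
  merge-≡ zero    c d = refl
  merge-≡ (suc a) c d = cong (shift 1) (merge-≡ a c d)

  shift-merge : ∀ w a c b d → merge (w + a) c (w + b) d ≡ shift w (merge a c b d)
  shift-merge zero    a c b d = sym (shift-0 (merge a c b d))
    where
    shift-0 : ∀ x → shift 0 x ≡ x
    shift-0 ∞          = refl
    shift-0 (best _ _) = refl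
  shift-merge (suc w) a c b d = trans (cong (shift 1) (shift-merge w a c b d)) (shift-suc (merge a c b d))
    where
    shift-suc : ∀ x → shift 1 (shift w x) ≡ shift (suc w) x
    shift-suc ∞          = refl
    shift-suc (best _ _) = refl

  shift-⊕ : ∀ w x y → shift w (x ⊕ y) ≡ shift w x ⊕ shift w y
  shift-⊕ w ∞          y          = refl
  shift-⊕ w (best a c) ∞          = refl
  shift-⊕ w (best a c) (best b d) = sym (shift-merge w a c b d)

module MinCountProperties {C : Set} {_+ᶜ_ : Op₂ C} (isCS : IsCommutativeSemigroup _≡_ _+ᶜ_) where

  open IsCommutativeSemigroup isCS using () renaming (assoc to +ᶜ-assoc; comm to +ᶜ-comm)
  open MinCountOps _+ᶜ_

  merge-comm : ∀ a c b d → merge a c b d ≡ merge b d a c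
  merge-comm zero    c zero    d = cong (best 0) (+ᶜ-comm c d)
  merge-comm zero    c (suc b) d = refl
  merge-comm (suc a) c zero    d = refl
  merge-comm (suc a) c (suc b) d = cong (shift 1) (merge-comm a c b d)

  ⊕-comm : ∀ x y → x ⊕ y ≡ y ⊕ x
  ⊕-comm ∞          y          = sym (⊕-identityʳ y)
  ⊕-comm (best a c) ∞          = refl
  ⊕-comm (best a c) (best b d) = merge-comm a c b d

  private
    shift1-⊕-best0 : ∀ x f → shift 1 x ⊕ best 0 f ≡ best 0 f
    shift1-⊕-best0 ∞          f = refl
    shift1-⊕-best0 (best _ _) f = refl

    best0-⊕-shift1 : ∀ x f → best 0 f ⊕ shift 1 x ≡ best 0 f
    best0-⊕-shift1 ∞          f = refl
    best0-⊕-shift1 (best _ _) f = refl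

  merge-assoc : ∀ a c b d e f → merge a c b d ⊕ best e f ≡ best a c ⊕ merge b d e f
  merge-assoc zero    c zero    d zero    f = cong (best 0) (+ᶜ-assoc c d f)
  merge-assoc zero    c zero    d (suc e) f = refl
  merge-assoc zero    c (suc b) d zero    f = refl
  merge-assoc zero    c (suc b) d (suc e) f = sym (best0-⊕-shift1 (merge b d e f) c)
  merge-assoc (suc a) c zero    d zero    f = refl
  merge-assoc (suc a) c zero    d (suc e) f = refl
  merge-assoc (suc a) c (suc b) d zero    f = shift1-⊕-best0 (merge a c b d) f
  merge-assoc (suc a) c (suc b) d (suc e) f = begin
    shift 1 (merge a c b d) ⊕ best (suc e) f    ≡⟨ shift-⊕ 1 (merge a c b d) (best e f) ⟨
    shift 1 (merge a c b d ⊕ best e f)          ≡⟨ cong (shift 1) (merge-assoc a c b d e f) ⟩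
    shift 1 (best a c ⊕ merge b d e f)          ≡⟨ shift-⊕ 1 (best a c) (merge b d e f) ⟩
    best (suc a) c ⊕ shift 1 (merge b d e f)    ∎

  ⊕-assoc : ∀ x y z → (x ⊕ y) ⊕ z ≡ x ⊕ (y ⊕ z)
  ⊕-assoc ∞          y          z          = refl
  ⊕-assoc (best a c) ∞          z          = refl
  ⊕-assoc (best a c) (best b d) ∞          = ⊕-identityʳ (merge a c b d)
  ⊕-assoc (best a c) (best b d) (best e f) = merge-assoc a c b d e f

  ⊕-isCommutativeMonoid : IsCommutativeMonoid _≡_ _⊕_ ∞
  ⊕-isCommutativeMonoid = record
    { isMonoid = record
      { isSemigroup = record
        { isMagma = record { isEquivalence = isEquivalence ; ∙-cong = cong₂ _⊕_ }
        ; assoc   = ⊕-assoc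
        }
      ; identity = (λ _ → refl) , ⊕-identityʳ
      }
    ; comm = ⊕-comm
    }

  ⊕-commutativeMonoid : CommutativeMonoid 0ℓ 0ℓ
  ⊕-commutativeMonoid = record { isCommutativeMonoid = ⊕-isCommutativeMonoid }

≟-MinCount : {C : Set} → DecidableEquality C → DecidableEquality (MinCount C)
≟-MinCount _≟ᶜ_ ∞          ∞          = yes refl
≟-MinCount _≟ᶜ_ ∞          (best _ _) = no (λ ())
≟-MinCount _≟ᶜ_ (best _ _) ∞          = no (λ ())
≟-MinCount _≟ᶜ_ (best a c) (best b d) =
  map′ (λ (p , q) → cong₂ best p q) (λ { refl → refl , refl }) (a ≟ b ×-dec c ≟ᶜ d)

module MapCount {C D : Set} {_+ᶜ_ : Op₂ C} {_+ᵈ_ : Op₂ D} (f : C → D)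
  (f-+ : ∀ c d → f (c +ᶜ d) ≡ f c +ᵈ f d) where

  open MinCountOps

  mapCount-merge : ∀ a c b d → mapCount f (merge _+ᶜ_ a c b d) ≡ merge _+ᵈ_ a (f c) b (f d)
  mapCount-merge zero    c zero    d = cong (best 0) (f-+ c d)
  mapCount-merge zero    c (suc b) d = refl
  mapCount-merge (suc a) c zero    d = refl
  mapCount-merge (suc a) c (suc b) d =
    trans (mapCount-shift1 (merge _+ᶜ_ a c b d)) (cong (shift 1) (mapCount-merge a c b d))
    where
    mapCount-shift1 : ∀ x → mapCount f (shift 1 x) ≡ shift 1 (mapCount f x)
    mapCount-shift1 ∞          = refl
    mapCount-shift1 (best _ _) = refl

  mapCount-⊕ : ∀ x y → mapCount f (_⊕_ _+ᶜ_ x y) ≡ _⊕_ _+ᵈ_ (mapCount f x) (mapCount f y)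
  mapCount-⊕ ∞          y          = refl
  mapCount-⊕ (best a c) ∞          = refl
  mapCount-⊕ (best a c) (best b d) = mapCount-merge a c b d

-- Vertex sets of the prism as words of rungs

bits : List Bool
bits = false ∷ true ∷ []

decode : ∀ {n} → List (Vertex n) → List Bool → VSet n
decode {n} (v ∷ vs) (b ∷ β) w = (b ∧ eqV n v w) ∨ decode vs β w
decode     _        _       w = false

subsetsOf-decode : ∀ {n} (vs : List (Vertex n)) → subsetsOf vs ≡ map (decode vs) (words bits (length vs))
subsetsOf-decode         []       = refl
subsetsOf-decode {n} (v ∷ vs) = sym (begin
  map D (map (false ∷_) W ++ (map (true ∷_) W ++ []))
    ≡⟨ cong (λ L → map D (map (false ∷_) W ++ L)) (++-identityʳ _) ⟩
  map D (map (false ∷_) W ++ map (true ∷_) W)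
    ≡⟨ map-++ D (map (false ∷_) W) _ ⟩
  map D (map (false ∷_) W) ++ map D (map (true ∷_) W)
    ≡⟨ cong₂ _++_ (map-∘ W) (map-∘ W) ⟨
  map (decode vs) W ++ map (insert ∘ decode vs) W
    ≡⟨ cong (map (decode vs) W ++_) (map-∘ W) ⟩
  map (decode vs) W ++ map insert (map (decode vs) W)
    ≡⟨ cong (λ R → R ++ map insert R) (subsetsOf-decode vs) ⟨
  subsetsOf vs ++ map insert (subsetsOf vs) ∎)
  where
  W = words bits (length vs)
  D = decode (v ∷ vs)
  insert : VSet n → VSet n
  insert S w = eqV n v w ∨ S w

-- Membership of the top and of the bottom vertex of one rung {(t,i), (b,i)}.
Rung : Set
Rung = Bool × Bool

layer : Bool → Rung → Bool
layer true  (t , b) = t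
layer false (t , b) = b

rungAt : List Rung → ℕ → Rung
rungAt = lookupOr (false , false)

weight : Rung → ℕ
weight (t , b) = indicator t + indicator b

decode-++ : ∀ {n} (xs ys : List (Vertex n)) β γ w → length β ≡ length xs →
            decode (xs ++ ys) (β ++ γ) w ≡ decode xs β w ∨ decode ys γ w
decode-++ []       ys []      γ w _  = refl
decode-++ (x ∷ xs) ys (b ∷ β) γ w eq =
  trans (cong (_ ∨_) (decode-++ xs ys β γ w (suc-injective eq))) (sym (∨-assoc (b ∧ eqV _ x w) _ _))

select : List ℕ → List Bool → ℕ → Bool
select (a ∷ as) (b ∷ β) x = (b ∧ (a ≡ᵇ x)) ∨ select as β x
select _        _       x = false

decode-layer : ∀ {n} s (is : List (Fin n)) β s′ j →
               decode (map (s ,_) is) β (s′ , j) ≡ (s ==B s′) ∧ select (map toℕ is) β (toℕ j)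
decode-layer s []       β       s′ j = sym (∧-zeroʳ _)
decode-layer s (i ∷ is) []      s′ j = sym (∧-zeroʳ _)
decode-layer s (i ∷ is) (b ∷ β) s′ j rewrite decode-layer s is β s′ j = factor (s ==B s′)
  where
  factor : ∀ x → (b ∧ (x ∧ (toℕ i ≡ᵇ toℕ j))) ∨ (x ∧ select (map toℕ is) β (toℕ j))
                 ≡ x ∧ ((b ∧ (toℕ i ≡ᵇ toℕ j)) ∨ select (map toℕ is) β (toℕ j))
  factor true  = refl
  factor false = cong (_∨ false) (∧-zeroʳ b)

select-map-suc : ∀ is β x → select (map suc is) β (suc x) ≡ select is β x
select-map-suc []       β       x = refl
select-map-suc (i ∷ is) []      x = refl
select-map-suc (i ∷ is) (b ∷ β) x = cong (_ ∨_) (select-map-suc is β x)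

select-map-suc-0 : ∀ is β → select (map suc is) β 0 ≡ false
select-map-suc-0 []       β       = refl
select-map-suc-0 (i ∷ is) []      = refl
select-map-suc-0 (i ∷ is) (b ∷ β) = trans (cong₂ _∨_ (∧-zeroʳ b) refl) (select-map-suc-0 is β)

select-upTo : ∀ n β x → x < n → select (upTo n) β x ≡ lookupOr false β x
select-upTo (suc n) []      x       _         = refl
select-upTo (suc n) (b ∷ β) zero    _
  rewrite sym (map-upTo suc n) | select-map-suc-0 (upTo n) β = trans (∨-identityʳ _) (∧-identityʳ b)
select-upTo (suc n) (b ∷ β) (suc x) (s≤s x<n)
  rewrite sym (map-upTo suc n) | ∧-zeroʳ b | select-map-suc (upTo n) β x = select-upTo n β x x<n

decode-vertices : ∀ n τ σ → length τ ≡ n → length σ ≡ n →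
                  ∀ s j → decode (vertices n) (τ ++ σ) (s , j) ≡ layer s (rungAt (zip τ σ) (toℕ j))
decode-vertices n τ σ ∣τ∣ ∣σ∣ s j = begin
  decode (tops ++ bottoms) (τ ++ σ) (s , j)
    ≡⟨ decode-++ tops bottoms τ σ (s , j) (trans ∣τ∣ (sym ∣tops∣)) ⟩
  decode tops τ (s , j) ∨ decode bottoms σ (s , j)
    ≡⟨ cong₂ _∨_ (decode-layer true (allFin n) τ s j) (decode-layer false (allFin n) σ s j) ⟩
  ((true ==B s) ∧ select indices τ (toℕ j)) ∨ ((false ==B s) ∧ select indices σ (toℕ j))
    ≡⟨ cong₂ (λ u v → ((true ==B s) ∧ u) ∨ ((false ==B s) ∧ v)) (pick τ) (pick σ) ⟩
  ((true ==B s) ∧ lookupOr false τ (toℕ j)) ∨ ((false ==B s) ∧ lookupOr false σ (toℕ j))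
    ≡⟨ by-layer s ⟩
  layer s (lookupOr false τ (toℕ j) , lookupOr false σ (toℕ j))
    ≡⟨ cong (layer s) (lookupOr-zip τ σ (trans ∣τ∣ (sym ∣σ∣)) (toℕ j)) ⟨
  layer s (rungAt (zip τ σ) (toℕ j)) ∎
  where
  tops    = map (true ,_) (allFin n)
  bottoms = map (false ,_) (allFin n)
  ∣tops∣ : length tops ≡ n
  ∣tops∣ = trans (length-map _ (allFin n)) (length-tabulate id)
  indices = map toℕ (allFin n)
  pick : ∀ β → select indices β (toℕ j) ≡ lookupOr false β (toℕ j)
  pick β = trans (cong (λ is → select is β (toℕ j)) (map-toℕ-allFin n))
                 (select-upTo n β (toℕ j) (toℕ<n j))
  by-layer : ∀ s {t b} → ((true ==B s) ∧ t) ∨ ((false ==B s) ∧ b) ≡ layer s (t , b)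
  by-layer true  = ∨-identityʳ _
  by-layer false = refl

-- Domination, rung by rung

rungDominated : Rung → Rung → Rung → Bool
rungDominated (tl , bl) (t , b) (tr , br) = (t ∨ ((tl ∨ tr) ∨ b)) ∧ (b ∨ (t ∨ (bl ∨ br)))

any-select : ∀ n (f : ℕ → Bool) {x} → x < n → any (λ y → f y ∧ (y ≡ᵇ x)) (upTo n) ≡ f x
any-select (suc n) f {zero} _ rewrite sym (map-upTo suc n) = begin
  (f 0 ∧ true) ∨ any (λ y → f y ∧ (y ≡ᵇ 0)) (map suc (upTo n))
    ≡⟨ cong (_ ∨_) (Any.⨁-map suc (upTo n) _) ⟩
  (f 0 ∧ true) ∨ any (λ y → f (suc y) ∧ false) (upTo n)
    ≡⟨ cong₂ _∨_ (∧-identityʳ (f 0)) (Any.⨁-cong (upTo n) (∧-zeroʳ ∘ f ∘ suc)) ⟩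
  f 0 ∨ any (λ _ → false) (upTo n)
    ≡⟨ cong (f 0 ∨_) (Any.⨁-ε (upTo n)) ⟩
  f 0 ∨ false
    ≡⟨ ∨-identityʳ (f 0) ⟩
  f 0 ∎
any-select (suc n) f {suc x} (s≤s x<n) rewrite sym (map-upTo suc n) | ∧-zeroʳ (f 0) =
  trans (Any.⨁-map suc (upTo n) _) (any-select n (f ∘ suc) x<n)

module Cycle (m : ℕ) where

  private
    n = suc m

  pred succ : ℕ → ℕ
  pred x = (x + m) % n
  succ x = suc x % n

  private
    %-absorbˡ : ∀ a b → (a % n + b) % n ≡ (a + b) % n
    %-absorbˡ a b = begin
      (a % n + b) % n           ≡⟨ %-distribˡ-+ (a % n) b n ⟩
      (a % n % n + b % n) % n   ≡⟨ cong (λ r → (r + b % n) % n) (m%n%n≡m%n a n) ⟩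
      (a % n + b % n) % n       ≡⟨ %-distribˡ-+ a b n ⟨
      (a + b) % n               ∎

  succ-% : ∀ x → succ (x % n) ≡ succ x
  succ-% x = begin
    suc (x % n) % n   ≡⟨ cong (_% n) (+-comm 1 (x % n)) ⟩
    (x % n + 1) % n   ≡⟨ %-absorbˡ x 1 ⟩
    (x + 1) % n       ≡⟨ cong (_% n) (+-comm x 1) ⟩
    suc x % n         ∎

  succ-pred : ∀ {x} → x < n → succ (pred x) ≡ x
  succ-pred {x} x<n = begin
    suc ((x + m) % n) % n   ≡⟨ cong (_% n) (+-comm 1 _) ⟩
    ((x + m) % n + 1) % n   ≡⟨ %-absorbˡ (x + m) 1 ⟩
    (x + m + 1) % n         ≡⟨ cong (_% n) (trans (+-assoc x m 1) (cong (x +_) (+-comm m 1))) ⟩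
    (x + n) % n             ≡⟨ [m+n]%n≡m%n x n ⟩
    x % n                   ≡⟨ m<n⇒m%n≡m x<n ⟩
    x                       ∎

  pred-succ : ∀ {y} → y < n → pred (succ y) ≡ y
  pred-succ {y} y<n = begin
    (suc y % n + m) % n     ≡⟨ %-absorbˡ (suc y) m ⟩
    (suc y + m) % n         ≡⟨ cong (_% n) (sym (+-suc y m)) ⟩
    (y + n) % n             ≡⟨ [m+n]%n≡m%n y n ⟩
    y % n                   ≡⟨ m<n⇒m%n≡m y<n ⟩
    y                       ∎

  succ≡ᵇ⇔≡ᵇpred : ∀ {x y} → x < n → y < n → (succ y ≡ᵇ x) ≡ (y ≡ᵇ pred x)
  succ≡ᵇ⇔≡ᵇpred {x} {y} x<n y<n = does-⇔ (mk⇔ to from) (succ y ≟ x) (y ≟ pred x)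
    where
    to : succ y ≡ x → y ≡ pred x
    to refl = sym (pred-succ y<n)
    from : y ≡ pred x → succ y ≡ x
    from refl = succ-pred x<n

  any-cycle-neighbours : ∀ (f : ℕ → Bool) {x} → x < n →
    any (λ y → f y ∧ (((succ y ≡ᵇ x) ∨ (succ x ≡ᵇ y)) ∨ false)) (upTo n) ≡ f (pred x) ∨ f (succ x)
  any-cycle-neighbours f {x} x<n = begin
    any (λ y → f y ∧ (((succ y ≡ᵇ x) ∨ (succ x ≡ᵇ y)) ∨ false)) (upTo n)
      ≡⟨ Any.⨁-cong-∈ (upTo n) (split ∘ ∈-upTo⁻) ⟩
    any (λ y → (f y ∧ (y ≡ᵇ pred x)) ∨ (f y ∧ (y ≡ᵇ succ x))) (upTo n)
      ≡⟨ Any.⨁-∙ (upTo n) (λ y → f y ∧ (y ≡ᵇ pred x)) (λ y → f y ∧ (y ≡ᵇ succ x)) ⟩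
    any (λ y → f y ∧ (y ≡ᵇ pred x)) (upTo n) ∨ any (λ y → f y ∧ (y ≡ᵇ succ x)) (upTo n)
      ≡⟨ cong₂ _∨_ (any-select n f (m%n<n (x + m) n)) (any-select n f (m%n<n (suc x) n)) ⟩
    f (pred x) ∨ f (succ x) ∎
    where
    split : ∀ {y} → y < n → f y ∧ (((succ y ≡ᵇ x) ∨ (succ x ≡ᵇ y)) ∨ false)
                            ≡ (f y ∧ (y ≡ᵇ pred x)) ∨ (f y ∧ (y ≡ᵇ succ x))
    split {y} y<n rewrite ∨-identityʳ ((succ y ≡ᵇ x) ∨ (succ x ≡ᵇ y)) | succ≡ᵇ⇔≡ᵇpred x<n y<n
                        | does-⇔ (mk⇔ sym sym) (succ x ≟ y) (y ≟ succ x) = ∧-distribˡ-∨ (f y) _ _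

  module _ (S : VSet n) (col : ℕ → Rung) (S≗col : ∀ s j → S (s , j) ≡ layer s (col (toℕ j))) where

    any-layer : ∀ s (g : ℕ → Bool) →
      any (λ k → S (s , k) ∧ g (toℕ k)) (allFin n) ≡ any (λ y → layer s (col y) ∧ g y) (upTo n)
    any-layer s g = begin
      any (λ k → S (s , k) ∧ g (toℕ k)) (allFin n)
        ≡⟨ Any.⨁-cong (allFin n) (λ k → cong (_∧ g (toℕ k)) (S≗col s k)) ⟩
      any (λ k → layer s (col (toℕ k)) ∧ g (toℕ k)) (allFin n)
        ≡⟨ Any.⨁-allFin n (λ y → layer s (col y) ∧ g y) ⟩
      any (λ y → layer s (col y) ∧ g y) (upTo n) ∎

    dominatedFrom : Bool → Bool → ℕ → Bool
    dominatedFrom s′ s x =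
      if s′ ==B s then layer s′ (col (pred x)) ∨ layer s′ (col (succ x)) else layer s′ (col x)

    any-adjacent-in-layer : ∀ s′ s j →
      any (λ k → S (s′ , k) ∧ adj n (s′ , k) (s , j)) (allFin n) ≡ dominatedFrom s′ s (toℕ j)
    any-adjacent-in-layer true true j =
      trans (any-layer true _) (any-cycle-neighbours (layer true ∘ col) (toℕ<n j))
    any-adjacent-in-layer true false j =
      trans (any-layer true (_≡ᵇ toℕ j)) (any-select n (layer true ∘ col) (toℕ<n j))
    any-adjacent-in-layer false true j =
      trans (any-layer false (_≡ᵇ toℕ j)) (any-select n (layer false ∘ col) (toℕ<n j))
    any-adjacent-in-layer false false j =
      trans (any-layer false _) (any-cycle-neighbours (layer false ∘ col) (toℕ<n j))

    private
      adjacentIn : Vertex n → Vertex n → Bool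
      adjacentIn v u = S u ∧ adj n u v

      dominated : Vertex n → Bool
      dominated v = S v ∨ any (adjacentIn v) (vertices n)

      dominatedAt : Bool → ℕ → Bool
      dominatedAt s x = layer s (col x) ∨ (dominatedFrom true s x ∨ dominatedFrom false s x)

      dominated-vertex : ∀ s j → dominated (s , j) ≡ dominatedAt s (toℕ j)
      dominated-vertex s j = begin
        S (s , j) ∨ any (adjacentIn (s , j)) (tops ++ bottoms)
          ≡⟨ cong₂ _∨_ (S≗col s j) (Any.⨁-++ tops bottoms (adjacentIn (s , j))) ⟩
        layer s (col (toℕ j)) ∨ (any (adjacentIn (s , j)) tops ∨ any (adjacentIn (s , j)) bottoms)
          ≡⟨ cong (layer s (col (toℕ j)) ∨_)
                  (cong₂ _∨_ (Any.⨁-map (true ,_) (allFin n) (adjacentIn (s , j)))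
                             (Any.⨁-map (false ,_) (allFin n) (adjacentIn (s , j)))) ⟩
        layer s (col (toℕ j)) ∨ (any (λ k → S (true , k) ∧ adj n (true , k) (s , j)) (allFin n)
                                 ∨ any (λ k → S (false , k) ∧ adj n (false , k) (s , j)) (allFin n))
          ≡⟨ cong (layer s (col (toℕ j)) ∨_)
                  (cong₂ _∨_ (any-adjacent-in-layer true s j) (any-adjacent-in-layer false s j)) ⟩
        dominatedAt s (toℕ j) ∎
        where
        tops    = map (true ,_) (allFin n)
        bottoms = map (false ,_) (allFin n)

      all-layer : ∀ s → all dominated (map (s ,_) (allFin n)) ≡ all (dominatedAt s) (upTo n)
      all-layer s = begin
        all dominated (map (s ,_) (allFin n))          ≡⟨ All.⨁-map (s ,_) (allFin n) dominated ⟩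
        all (λ j → dominated (s , j)) (allFin n)       ≡⟨ All.⨁-cong (allFin n) (dominated-vertex s) ⟩
        all (λ j → dominatedAt s (toℕ j)) (allFin n)   ≡⟨ All.⨁-allFin n (dominatedAt s) ⟩
        all (dominatedAt s) (upTo n)                   ∎

    isDominating-rungs :
      isDominating n S ≡ all (λ x → rungDominated (col (pred x)) (col x) (col (succ x))) (upTo n)
    isDominating-rungs = begin
      isDominating n S
        ≡⟨ All.⨁-++ (map (true ,_) (allFin n)) (map (false ,_) (allFin n)) dominated ⟩
      all dominated (map (true ,_) (allFin n)) ∧ all dominated (map (false ,_) (allFin n))
        ≡⟨ cong₂ _∧_ (all-layer true) (all-layer false) ⟩
      all (dominatedAt true) (upTo n) ∧ all (dominatedAt false) (upTo n)
        ≡⟨ All.⨁-∙ (upTo n) (dominatedAt true) (dominatedAt false) ⟨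
      all (λ x → rungDominated (col (pred x)) (col x) (col (succ x))) (upTo n) ∎

module CyclicWindows {A : Set} (d : A) (P : A → A → A → Bool) where

  private
    _!_ : List A → ℕ → A
    _!_ = lookupOr d

  windows : List A → Bool
  windows (x ∷ y ∷ z ∷ rest) = P x y z ∧ windows (y ∷ z ∷ rest)
  windows _                  = true

  windows-all : ∀ L → windows L ≡ all (λ k → P (L ! k) (L ! suc k) (L ! suc (suc k))) (upTo (length L ∸ 2))
  windows-all []                 = refl
  windows-all (x ∷ [])           = refl
  windows-all (x ∷ y ∷ [])       = refl
  windows-all (x ∷ y ∷ z ∷ rest) = cong (P x y z ∧_) (begin
    windows (y ∷ z ∷ rest)
      ≡⟨ windows-all (y ∷ z ∷ rest) ⟩
    all (λ k → P (L ! suc k) (L ! suc (suc k)) (L ! suc (suc (suc k)))) (upTo (length rest))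
      ≡⟨ All.⨁-map suc (upTo (length rest)) _ ⟨
    all (λ k → P (L ! k) (L ! suc k) (L ! suc (suc k))) (map suc (upTo (length rest)))
      ≡⟨ cong (all _) (map-upTo suc (length rest)) ⟩
    all (λ k → P (L ! k) (L ! suc k) (L ! suc (suc k))) (applyUpTo suc (length rest)) ∎)
    where L = x ∷ y ∷ z ∷ rest

  module _ (m : ℕ) where

    open Cycle (suc m)

    private
      n = suc (suc m)

    module _ (a b : A) (r : List A) (∣r∣ : length r ≡ m) where

      private
        w  = a ∷ b ∷ r
        w⁺ = w ++ a ∷ b ∷ []

        ∣w∣ : length w ≡ n
        ∣w∣ = cong (suc ∘ suc) ∣r∣

        wraps : ∀ {j} → j < n + 2 → w⁺ ! j ≡ w ! (j % n)
        wraps {j} j<n+2 with j <? n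
        ... | yes j<n =
          trans (lookupOr-++ˡ w _ (subst (j <_) (sym ∣w∣) j<n)) (cong (w !_) (sym (m<n⇒m%n≡m j<n)))
        ... | no  j≮n = begin
          w⁺ ! j                    ≡⟨ cong (w⁺ !_) j≡ ⟩
          w⁺ ! (length w + i)       ≡⟨ lookupOr-++ʳ w (a ∷ b ∷ []) i ⟩
          (a ∷ b ∷ []) ! i          ≡⟨ small i<2 ⟩
          w ! i                     ≡⟨ cong (w !_) (m<n⇒m%n≡m (≤-trans i<2 (s≤s (s≤s z≤n)))) ⟨
          w ! (i % n)               ≡⟨ cong (w !_) ([m+n]%n≡m%n i n) ⟨
          w ! ((i + n) % n)         ≡⟨ cong (λ k → w ! (k % n)) (trans (+-comm i n) (cong (_+ i) (sym ∣w∣))) ⟩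
          w ! ((length w + i) % n)  ≡⟨ cong (λ k → w ! (k % n)) j≡ ⟨
          w ! (j % n)               ∎
          where
          i = j ∸ n
          j≡ : j ≡ length w + i
          j≡ = trans (sym (m+[n∸m]≡n (≮⇒≥ j≮n))) (cong (_+ i) (sym ∣w∣))
          i<2 : i < 2
          i<2 = +-cancelˡ-< n i 2 (subst (_< n + 2) (sym (m+[n∸m]≡n (≮⇒≥ j≮n))) j<n+2)
          small : ∀ {i} → i < 2 → (a ∷ b ∷ []) ! i ≡ w ! i
          small {zero}        _               = refl
          small {suc zero}    _               = refl
          small {suc (suc _)} (s≤s (s≤s ()))

      cyclic≡windows : all (λ x → P (w ! pred x) (w ! x) (w ! succ x)) (upTo n) ≡ windows w⁺
      cyclic≡windows = begin
        all (λ x → P (w ! pred x) (w ! x) (w ! succ x)) (upTo n)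
          ≡⟨ All.⨁-rotate (suc m) (λ x → P (w ! pred x) (w ! x) (w ! succ x)) ⟨
        all (λ k → P (w ! pred (succ k)) (w ! succ k) (w ! succ (succ k))) (upTo n)
          ≡⟨ All.⨁-cong-∈ (upTo n) (shifted ∘ ∈-upTo⁻) ⟩
        all (λ k → P (w⁺ ! k) (w⁺ ! suc k) (w⁺ ! suc (suc k))) (upTo n)
          ≡⟨ cong (λ l → all (λ k → P (w⁺ ! k) (w⁺ ! suc k) (w⁺ ! suc (suc k))) (upTo l)) ∣w⁺∣∸2 ⟨
        all (λ k → P (w⁺ ! k) (w⁺ ! suc k) (w⁺ ! suc (suc k))) (upTo (length w⁺ ∸ 2))
          ≡⟨ windows-all w⁺ ⟨
        windows w⁺ ∎
        where
        ∣w⁺∣∸2 : length w⁺ ∸ 2 ≡ n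
        ∣w⁺∣∸2 = trans (cong (_∸ 2) (length-++ w)) (trans (cong (λ l → l + 2 ∸ 2) ∣w∣) (m+n∸n≡m n 2))
        shifted : ∀ {k} → k < n → P (w ! pred (succ k)) (w ! succ k) (w ! succ (succ k))
                                ≡ P (w⁺ ! k) (w⁺ ! suc k) (w⁺ ! suc (suc k))
        shifted {k} k<n = cong₃ P
          (trans (cong (w !_) (trans (pred-succ k<n) (sym (m<n⇒m%n≡m k<n)))) (sym (wraps k<n+2)))
          (sym (wraps 1+k<n+2))
          (trans (cong (w !_) (succ-% (suc k))) (sym (wraps 2+k<n+2)))
          where
          2+k<n+2 : 2 + k < n + 2
          2+k<n+2 = subst (3 + k ≤_) (+-comm 2 n) (s≤s (s≤s k<n))
          1+k<n+2 : 1 + k < n + 2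
          1+k<n+2 = ≤-trans (n≤1+n _) 2+k<n+2
          k<n+2 : k < n + 2
          k<n+2 = ≤-trans (n≤1+n _) 1+k<n+2

module _ {n} (S : VSet n) (col : ℕ → Rung) (S≗col : ∀ s j → S (s , j) ≡ layer s (col (toℕ j))) where

  size-rungs : size n S ≡ Sum.⨁[ x ← upTo n ] weight (col x)
  size-rungs = begin
    size n S                                                     ≡⟨ length-filterᵇ S (vertices n) ⟩
    Sum.⨁ (map (true ,_) (allFin n) ++ map (false ,_) (allFin n)) (indicator ∘ S)
      ≡⟨ Sum.⨁-++ (map (true ,_) (allFin n)) (map (false ,_) (allFin n)) (indicator ∘ S) ⟩
    Sum.⨁ (map (true ,_) (allFin n)) (indicator ∘ S) + Sum.⨁ (map (false ,_) (allFin n)) (indicator ∘ S)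
      ≡⟨ cong₂ _+_ (layer-size true) (layer-size false) ⟩
    (Sum.⨁[ x ← upTo n ] indicator (layer true (col x))) + (Sum.⨁[ x ← upTo n ] indicator (layer false (col x)))
      ≡⟨ Sum.⨁-∙ (upTo n) (indicator ∘ layer true ∘ col) (indicator ∘ layer false ∘ col) ⟨
    Sum.⨁[ x ← upTo n ] weight (col x)                            ∎
    where
    layer-size : ∀ s → Sum.⨁ (map (s ,_) (allFin n)) (indicator ∘ S)
                       ≡ Sum.⨁[ x ← upTo n ] indicator (layer s (col x))
    layer-size s = begin
      Sum.⨁ (map (s ,_) (allFin n)) (indicator ∘ S)
        ≡⟨ Sum.⨁-map (s ,_) (allFin n) (indicator ∘ S) ⟩
      Sum.⨁[ j ← allFin n ] indicator (S (s , j))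
        ≡⟨ Sum.⨁-cong (allFin n) (cong indicator ∘ S≗col s) ⟩
      Sum.⨁[ j ← allFin n ] indicator (layer s (col (toℕ j)))
        ≡⟨ Sum.⨁-allFin n (indicator ∘ layer s ∘ col) ⟩
      Sum.⨁[ x ← upTo n ] indicator (layer s (col x)) ∎

open CyclicWindows (false , false) rungDominated

rungs : List Rung
rungs = cartesianProduct bits bits

-- The transfer matrix

-- Functions on pairs of rungs are stored as nested pairs, so that evaluating the iterated transfer
-- step computes every entry of a table once instead of re-deriving it at each lookup.
Pair : Set → Set
Pair A = A × A

tabulateᵇ : {A : Set} → (Bool → A) → Pair A
tabulateᵇ f = f false , f true

lookupᵇ : {A : Set} → Pair A → Bool → A
lookupᵇ (x , y) false = x
lookupᵇ (x , y) true  = y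

lookupᵇ-tabulateᵇ : {A : Set} (f : Bool → A) → ∀ b → lookupᵇ (tabulateᵇ f) b ≡ f b
lookupᵇ-tabulateᵇ f false = refl
lookupᵇ-tabulateᵇ f true  = refl

mapᴾ : {A B : Set} → (A → B) → Pair A → Pair B
mapᴾ f (x , y) = f x , f y

lookupᵇ-mapᴾ : {A B : Set} (f : A → B) (p : Pair A) → ∀ b → lookupᵇ (mapᴾ f p) b ≡ f (lookupᵇ p b)
lookupᵇ-mapᴾ f p false = refl
lookupᵇ-mapᴾ f p true  = refl

RungTable : Set → Set
RungTable A = Pair (Pair A)

tabulateᴿ : {A : Set} → (Rung → A) → RungTable A
tabulateᴿ f = tabulateᵇ (λ t → tabulateᵇ (λ b → f (t , b)))

lookupᴿ : {A : Set} → RungTable A → Rung → A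
lookupᴿ T (t , b) = lookupᵇ (lookupᵇ T t) b

lookupᴿ-tabulateᴿ : {A : Set} (f : Rung → A) → ∀ x → lookupᴿ (tabulateᴿ f) x ≡ f x
lookupᴿ-tabulateᴿ f (t , b) =
  trans (cong (λ T → lookupᵇ T b) (lookupᵇ-tabulateᵇ (λ t → tabulateᵇ (λ b → f (t , b))) t))
        (lookupᵇ-tabulateᵇ (λ b → f (t , b)) b)

Table : Set → Set
Table A = RungTable (RungTable A)

tabulate₂ : {A : Set} → (Rung → Rung → A) → Table A
tabulate₂ f = tabulateᴿ (λ x → tabulateᴿ (f x))

lookup₂ : {A : Set} → Table A → Rung → Rung → A
lookup₂ T x = lookupᴿ (lookupᴿ T x)

lookup₂-tabulate₂ : {A : Set} (f : Rung → Rung → A) → ∀ x y → lookup₂ (tabulate₂ f) x y ≡ f x y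
lookup₂-tabulate₂ f x y =
  trans (cong (λ T → lookupᴿ T y) (lookupᴿ-tabulateᴿ (λ x → tabulateᴿ (f x)) x))
        (lookupᴿ-tabulateᴿ (f x) y)

mapTable : {A B : Set} → (A → B) → Table A → Table B
mapTable f = mapᴾ (mapᴾ (mapᴾ (mapᴾ f)))

lookup₂-mapTable : {A B : Set} (f : A → B) (T : Table A) →
                   ∀ x y → lookup₂ (mapTable f T) x y ≡ f (lookup₂ T x y)
lookup₂-mapTable f T (t , b) (t′ , b′) = begin
  lookupᵇ (lookupᵇ (lookupᵇ (lookupᵇ (mapTable f T) t) b) t′) b′
    ≡⟨ cong (λ p → lookupᵇ (lookupᵇ (lookupᵇ p b) t′) b′) (lookupᵇ-mapᴾ (mapᴾ (mapᴾ (mapᴾ f))) T t) ⟩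
  lookupᵇ (lookupᵇ (lookupᵇ (mapᴾ (mapᴾ (mapᴾ f)) (lookupᵇ T t)) b) t′) b′
    ≡⟨ cong (λ p → lookupᵇ (lookupᵇ p t′) b′) (lookupᵇ-mapᴾ (mapᴾ (mapᴾ f)) (lookupᵇ T t) b) ⟩
  lookupᵇ (lookupᵇ (mapᴾ (mapᴾ f) (lookupᵇ (lookupᵇ T t) b)) t′) b′
    ≡⟨ cong (λ p → lookupᵇ p b′) (lookupᵇ-mapᴾ (mapᴾ f) (lookupᵇ (lookupᵇ T t) b) t′) ⟩
  lookupᵇ (mapᴾ f (lookupᵇ (lookupᵇ (lookupᵇ T t) b) t′)) b′
    ≡⟨ lookupᵇ-mapᴾ f _ b′ ⟩
  f (lookup₂ T (t , b) (t′ , b′)) ∎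

tabulate₂-injective : {A : Set} (f g : Rung → Rung → A) → tabulate₂ f ≡ tabulate₂ g →
                      ∀ x y → f x y ≡ g x y
tabulate₂-injective f g eq x y =
  trans (sym (lookup₂-tabulate₂ f x y)) (trans (cong (λ T → lookup₂ T x y) eq) (lookup₂-tabulate₂ g x y))

≟-Pair : {A : Set} → DecidableEquality A → DecidableEquality (Pair A)
≟-Pair _≟ᴬ_ (x , y) (x′ , y′) = map′ (uncurry (cong₂ _,_)) ,-injective (x ≟ᴬ x′ ×-dec y ≟ᴬ y′)

≟-Table : {A : Set} → DecidableEquality A → DecidableEquality (Table A)
≟-Table = ≟-Pair ∘ ≟-Pair ∘ ≟-Pair ∘ ≟-Pair

module Transfer {C : Set} (_+ᶜ_ : Op₂ C) where

  open MinCountOps _+ᶜ_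
  open BigOp _⊕_ ∞

  step : (Rung → Rung → MinCount C) → Rung → Rung → MinCount C
  step V x y = ⨁[ z ← rungs ] (if rungDominated x y z then shift (weight z) (V y z) else ∞)

  step-cong : ∀ {V W} → (∀ x y → V x y ≡ W x y) → ∀ x y → step V x y ≡ step W x y
  step-cong V≗W x y =
    ⨁-cong rungs (λ z → cong (λ v → if rungDominated x y z then shift (weight z) v else ∞) (V≗W y z))

  iterate : ℕ → Table (MinCount C) → Table (MinCount C)
  iterate zero    T = T
  iterate (suc m) T = tabulate₂ (step (lookup₂ (iterate m T)))

  lookup₂-iterate : ∀ m T x y → lookup₂ (iterate (suc m) T) x y ≡ step (lookup₂ (iterate m T)) x y
  lookup₂-iterate m T = lookup₂-tabulate₂ (step (lookup₂ (iterate m T)))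

  cycleTotal : (Rung → Rung → MinCount C) → MinCount C
  cycleTotal D = ⨁[ a ← rungs ] ⨁[ b ← rungs ] shift (weight a + weight b) (D a b)

open MinCountOps _+_
open MinCountProperties +-isCommutativeSemigroup
open BigOpProperties ⊕-isCommutativeMonoid
open import Algebra.Properties.CommutativeSemigroup (CommutativeMonoid.commutativeSemigroup ⊕-commutativeMonoid)
  using () renaming (x∙yz≈y∙xz to ⊕-x∙yz≈y∙xz)
open import Algebra.Properties.CommutativeSemigroup +-commutativeSemigroup using (x∙yz≈y∙xz)

module Tally {X : Set} (g : X → ℕ) where

  tally : List X → MinCount ℕ
  tally xs = ⨁[ x ← xs ] best (g x) 1

  occurrences : ℕ → List X → ℕ
  occurrences v xs = length (filterᵇ (λ x → g x ≡ᵇ v) xs)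

  private
    least : X → List X → ℕ
    least x xs = foldr _⊓_ (g x) (map g xs)

  occurrences-∷ : ∀ v x xs → occurrences v (x ∷ xs) ≡ indicator (g x ≡ᵇ v) + occurrences v xs
  occurrences-∷ v x xs with g x ≡ᵇ v
  ... | true  = refl
  ... | false = refl

  occurrences-∷₂ : ∀ v x y xs →
                   occurrences v (x ∷ y ∷ xs) ≡ indicator (g y ≡ᵇ v) + occurrences v (x ∷ xs)
  occurrences-∷₂ v x y xs = begin
    occurrences v (x ∷ y ∷ xs)                 ≡⟨ occurrences-∷ v x (y ∷ xs) ⟩
    [x] + occurrences v (y ∷ xs)               ≡⟨ cong ([x] +_) (occurrences-∷ v y xs) ⟩
    [x] + ([y] + occurrences v xs)             ≡⟨ x∙yz≈y∙xz [x] [y] (occurrences v xs) ⟩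
    [y] + ([x] + occurrences v xs)             ≡⟨ cong ([y] +_) (occurrences-∷ v x xs) ⟨
    [y] + occurrences v (x ∷ xs)               ∎
    where
    [x] = indicator (g x ≡ᵇ v)
    [y] = indicator (g y ≡ᵇ v)

  occurrences-below-least : ∀ v x xs → v < least x xs → occurrences v (x ∷ xs) ≡ 0
  occurrences-below-least v x []       v<gx =
    trans (occurrences-∷ v x []) (cong (_+ 0) (indicator-≢ (>⇒≢ v<gx)))
  occurrences-below-least v x (y ∷ xs) v<m  = begin
    occurrences v (x ∷ y ∷ xs)                     ≡⟨ occurrences-∷₂ v x y xs ⟩
    indicator (g y ≡ᵇ v) + occurrences v (x ∷ xs)  ≡⟨ cong₂ _+_ (indicator-≢ (>⇒≢ v<gy))
                                                                (occurrences-below-least v x xs v<least) ⟩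
    0                                              ∎
    where
    v<gy    = <-≤-trans v<m (m⊓n≤m (g y) (least x xs))
    v<least = <-≤-trans v<m (m⊓n≤n (g y) (least x xs))

  tally-∷ : ∀ x xs → tally (x ∷ xs) ≡ best (least x xs) (occurrences (least x xs) (x ∷ xs))
  tally-∷ x []       =
    cong (best (g x)) (sym (trans (occurrences-∷ (g x) x []) (cong (_+ 0) (indicator-≡ (refl {x = g x})))))
  tally-∷ x (y ∷ xs) = begin
    best (g x) 1 ⊕ (best (g y) 1 ⊕ tally xs)             ≡⟨ ⊕-x∙yz≈y∙xz (best (g x) 1) (best (g y) 1) (tally xs) ⟩
    best (g y) 1 ⊕ tally (x ∷ xs)                        ≡⟨ cong (best (g y) 1 ⊕_) (tally-∷ x xs) ⟩
    merge (g y) 1 m c                                    ≡⟨ by-cases (<-cmp (g y) m) ⟩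
    best (g y ⊓ m) (occurrences (g y ⊓ m) (x ∷ y ∷ xs))  ∎
    where
    m = least x xs
    c = occurrences m (x ∷ xs)
    by-cases : Tri (g y < m) (g y ≡ m) (m < g y) →
               merge (g y) 1 m c ≡ best (g y ⊓ m) (occurrences (g y ⊓ m) (x ∷ y ∷ xs))
    by-cases (tri< gy<m _ _) rewrite m≤n⇒m⊓n≡m (<⇒≤ gy<m) | occurrences-∷₂ (g y) x y xs
                                   | indicator-≡ (refl {x = g y}) | occurrences-below-least (g y) x xs gy<m =
      merge-< 1 _ gy<m
    by-cases (tri≈ _ gy≡m _) = begin
      merge (g y) 1 m c                      ≡⟨ cong (λ a → merge a 1 m c) gy≡m ⟩
      merge m 1 m c                          ≡⟨ merge-≡ m 1 c ⟩
      best m (1 + c)                         ≡⟨ cong (λ i → best m (i + c)) (indicator-≡ gy≡m) ⟨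
      best m (indicator (g y ≡ᵇ m) + c)         ≡⟨ cong (best m) (occurrences-∷₂ m x y xs) ⟨
      best m (occurrences m (x ∷ y ∷ xs))
        ≡⟨ cong (λ a → best a (occurrences a (x ∷ y ∷ xs))) (trans (cong (_⊓ m) gy≡m) (⊓-idem m)) ⟨
      best (g y ⊓ m) (occurrences (g y ⊓ m) (x ∷ y ∷ xs)) ∎
    by-cases (tri> _ _ m<gy)
      rewrite m≥n⇒m⊓n≡n (<⇒≤ m<gy) | occurrences-∷₂ m x y xs | indicator-≢ (>⇒≢ m<gy) = merge-> 1 _ m<gy

  minimum-occurrences : ∀ xs {a c} → tally xs ≡ best a c →
    minimumWith 0 (map g xs) ≡ a × occurrences (minimumWith 0 (map g xs)) xs ≡ c
  minimum-occurrences (x ∷ xs) eq with trans (sym (tally-∷ x xs)) eq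
  ... | refl = refl , refl

open Tally

dominionSummand : ∀ n → VSet n → MinCount ℕ
dominionSummand n S = if isDominating n S then best (size n S) 1 else ∞

cycleSummand : List Rung → MinCount ℕ
cycleSummand w = if windows (w ++ take 2 w) then best (Sum.⨁ w weight) 1 else ∞

dominionSummand-decode : ∀ m τ σ → length τ ≡ 2 + m → length σ ≡ 2 + m →
  dominionSummand (2 + m) (decode (vertices (2 + m)) (τ ++ σ)) ≡ cycleSummand (zip τ σ)
dominionSummand-decode m τ@(t₀ ∷ t₁ ∷ τ′) σ@(s₀ ∷ s₁ ∷ σ′) ∣τ∣ ∣σ∣ =
  cong₂ (λ d c → if d then best c 1 else ∞) dominating sized
  where
  n = 2 + m
  S = decode (vertices n) (τ ++ σ)
  w = zip τ σ
  S≗w : ∀ s j → S (s , j) ≡ layer s (rungAt w (toℕ j))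
  S≗w = decode-vertices n τ σ ∣τ∣ ∣σ∣
  ∣w∣ : length w ≡ n
  ∣w∣ = trans (length-zipWith _,_ τ σ) (trans (cong₂ _⊓_ ∣τ∣ ∣σ∣) (⊓-idem n))
  dominating : isDominating n S ≡ windows (w ++ take 2 w)
  dominating = trans (Cycle.isDominating-rungs (suc m) S (rungAt w) S≗w)
                     (cyclic≡windows m (t₀ , s₀) (t₁ , s₁) (zip τ′ σ′) (suc-injective (suc-injective ∣w∣)))
  sized : size n S ≡ Sum.⨁ w weight
  sized = begin
    size n S                                ≡⟨ size-rungs S (rungAt w) S≗w ⟩
    Sum.⨁[ x ← upTo n ] weight (rungAt w x) ≡⟨ cong (λ l → Sum.⨁[ x ← upTo l ] weight (rungAt w x)) ∣w∣ ⟨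
    Sum.⨁[ x ← upTo (length w) ] weight (rungAt w x) ≡⟨ Sum.⨁-lookupOr w weight ⟩
    Sum.⨁ w weight                          ∎

length-vertices : ∀ n → length (vertices n) ≡ n + n
length-vertices n = trans (length-++ (layer-vertices true)) (cong₂ _+_ (length-layer true) (length-layer false))
  where
  layer-vertices : Bool → List (Vertex n)
  layer-vertices s = map (s ,_) (allFin n)
  length-layer : ∀ s → length (layer-vertices s) ≡ n
  length-layer s = trans (length-map (s ,_) (allFin n)) (length-tabulate {n = n} (λ i → i))

dominion-sum : ∀ m → tally (size (2 + m)) (dominatingSets (2 + m)) ≡ ⨁ (words rungs (2 + m)) cycleSummand
dominion-sum m = begin
  ⨁ (dominatingSets n) (λ S → best (size n S) 1)
    ≡⟨ ⨁-filter (isDominating n) (allSubsets n) _ ⟩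
  ⨁ (allSubsets n) (dominionSummand n)
    ≡⟨ cong (λ Ss → ⨁ Ss (dominionSummand n)) (subsetsOf-decode (vertices n)) ⟩
  ⨁ (map (decode (vertices n)) (words bits (length (vertices n)))) (dominionSummand n)
    ≡⟨ ⨁-map (decode (vertices n)) (words bits (length (vertices n))) (dominionSummand n) ⟩
  ⨁ (words bits (length (vertices n))) (dominionSummand n ∘ decode (vertices n))
    ≡⟨ cong (λ l → ⨁ (words bits l) (dominionSummand n ∘ decode (vertices n))) (length-vertices n) ⟩
  ⨁ (words bits (n + n)) (dominionSummand n ∘ decode (vertices n))
    ≡⟨ ⨁-words-+ bits n n _ ⟩
  ⨁[ τ ← words bits n ] ⨁[ σ ← words bits n ] dominionSummand n (decode (vertices n) (τ ++ σ))
    ≡⟨ ⨁-words-cong bits n (λ τ ∣τ∣ → ⨁-words-cong bits n (λ σ ∣σ∣ →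
         dominionSummand-decode m τ σ ∣τ∣ ∣σ∣)) ⟩
  ⨁[ τ ← words bits n ] ⨁[ σ ← words bits n ] cycleSummand (zip τ σ)
    ≡⟨ ⨁-words-zip bits bits n cycleSummand ⟩
  ⨁ (words rungs n) cycleSummand ∎
  where
  n = 2 + m

open Transfer _+_

⨁-shift : {X : Set} (w : ℕ) (xs : List X) (f : X → MinCount ℕ) →
          shift w (⨁ xs f) ≡ ⨁[ x ← xs ] shift w (f x)
⨁-shift w = BigOpHomomorphism.⨁-hom (shift w) refl (shift-⊕ w)

closing : Rung → Rung → Rung → Rung → List Rung → MinCount ℕ
closing a b x y r = if windows (x ∷ y ∷ r ++ a ∷ b ∷ []) then best (Sum.⨁ r weight) 1 else ∞

completions : Rung → Rung → ℕ → Rung → Rung → MinCount ℕ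
completions a b m x y = ⨁[ r ← words rungs m ] closing a b x y r

boundary : Rung → Rung → Table (MinCount ℕ)
boundary a b = tabulate₂ (λ x y → closing a b x y [])

completions≡iterate : ∀ a b m x y → completions a b m x y ≡ lookup₂ (iterate m (boundary a b)) x y
completions≡iterate a b zero    x y =
  trans (⊕-identityʳ _) (sym (lookup₂-tabulate₂ (λ x y → closing a b x y []) x y))
completions≡iterate a b (suc m) x y = begin
  completions a b (suc m) x y
    ≡⟨ ⨁-words-suc rungs m (closing a b x y) ⟩
  ⨁[ z ← rungs ] ⨁[ r ← words rungs m ] closing a b x y (z ∷ r)
    ≡⟨ ⨁-cong rungs (λ z → ⨁-cong (words rungs m) (split (rungDominated x y z) z)) ⟩
  ⨁[ z ← rungs ] ⨁[ r ← words rungs m ]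
    (if rungDominated x y z then shift (weight z) (closing a b y z r) else ∞)
    ≡⟨ ⨁-cong rungs (λ z → pull (rungDominated x y z) z) ⟩
  step (completions a b m) x y
    ≡⟨ step-cong (completions≡iterate a b m) x y ⟩
  step (lookup₂ (iterate m (boundary a b))) x y
    ≡⟨ lookup₂-iterate m (boundary a b) x y ⟨
  lookup₂ (iterate (suc m) (boundary a b)) x y ∎
  where
  split : ∀ d z r →
          (if d ∧ windows (y ∷ z ∷ r ++ a ∷ b ∷ []) then best (weight z + Sum.⨁ r weight) 1 else ∞)
          ≡ (if d then shift (weight z) (closing a b y z r) else ∞)
  split false z r = refl
  split true  z r with windows (y ∷ z ∷ r ++ a ∷ b ∷ [])
  ... | true  = refl
  ... | false = refl
  pull : ∀ d z → ⨁[ r ← words rungs m ] (if d then shift (weight z) (closing a b y z r) else ∞)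
                 ≡ (if d then shift (weight z) (completions a b m y z) else ∞)
  pull true  z = sym (⨁-shift (weight z) (words rungs m) (closing a b y z))
  pull false z = ⨁-ε (words rungs m)

prismTally : ℕ → MinCount ℕ
prismTally m = cycleTotal (λ a b → lookup₂ (iterate m (boundary a b)) a b)

cycle-sum : ∀ m → ⨁ (words rungs (2 + m)) cycleSummand ≡ prismTally m
cycle-sum m = begin
  ⨁ (words rungs (2 + m)) cycleSummand
    ≡⟨ ⨁-words-suc rungs (suc m) cycleSummand ⟩
  ⨁[ a ← rungs ] ⨁[ w ← words rungs (suc m) ] cycleSummand (a ∷ w)
    ≡⟨ ⨁-cong rungs (λ a → ⨁-words-suc rungs m (cycleSummand ∘′ (a ∷_))) ⟩
  ⨁[ a ← rungs ] ⨁[ b ← rungs ] ⨁[ r ← words rungs m ] cycleSummand (a ∷ b ∷ r)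
    ≡⟨ ⨁-cong rungs (λ a → ⨁-cong rungs (λ b → closed a b)) ⟩
  prismTally m ∎
  where
  closed : ∀ a b → ⨁[ r ← words rungs m ] cycleSummand (a ∷ b ∷ r)
                   ≡ shift (weight a + weight b) (lookup₂ (iterate m (boundary a b)) a b)
  closed a b = begin
    ⨁[ r ← words rungs m ] cycleSummand (a ∷ b ∷ r)
      ≡⟨ ⨁-cong (words rungs m) (λ r → regroup (windows (a ∷ b ∷ r ++ a ∷ b ∷ [])) (Sum.⨁ r weight)) ⟩
    ⨁[ r ← words rungs m ] shift (weight a + weight b) (closing a b a b r)
      ≡⟨ ⨁-shift (weight a + weight b) (words rungs m) (closing a b a b) ⟨
    shift (weight a + weight b) (completions a b m a b)
      ≡⟨ cong (shift (weight a + weight b)) (completions≡iterate a b m a b) ⟩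
    shift (weight a + weight b) (lookup₂ (iterate m (boundary a b)) a b) ∎
    where
    regroup : ∀ d v → (if d then best (weight a + (weight b + v)) 1 else ∞)
                      ≡ shift (weight a + weight b) (if d then best v 1 else ∞)
    regroup false v = refl
    regroup true  v = cong (λ u → best u 1) (sym (+-assoc (weight a) (weight b) v))

prismTally-γ-ζ : ∀ m {a c} → prismTally m ≡ best a c → γ (2 + m) ≡ a × ζ (2 + m) ≡ c
prismTally-γ-ζ m eq = minimum-occurrences (size (2 + m)) (dominatingSets (2 + m))
  (trans (dominion-sum m) (trans (cycle-sum m) eq))

-- Periodicity

record Quad : Set where
  constructor quad
  field
    c₀ c₁ c₂ : ℕ

valueAt : ℕ → Quad → ℕ
valueAt k (quad a b c) = a + b * k + c * (k C 2)

infixl 6 _+Q_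

_+Q_ : Quad → Quad → Quad
quad a b c +Q quad a′ b′ c′ = quad (a + a′) (b + b′) (c + c′)

advance : Quad → Quad
advance (quad a b c) = quad (a + b) (b + c) c

+Q-isCommutativeSemigroup : IsCommutativeSemigroup _≡_ _+Q_
+Q-isCommutativeSemigroup = record
  { isSemigroup = record
    { isMagma = record { isEquivalence = isEquivalence ; ∙-cong = cong₂ _+Q_ }
    ; assoc   = λ { (quad a b c) (quad a′ b′ c′) (quad a″ b″ c″) →
                    cong₃ quad (+-assoc a a′ a″) (+-assoc b b′ b″) (+-assoc c c′ c″) }
    }
  ; comm = λ { (quad a b c) (quad a′ b′ c′) → cong₃ quad (+-comm a a′) (+-comm b b′) (+-comm c c′) }
  }

infix 4 _≟Q_

_≟Q_ : DecidableEquality Quad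
quad a b c ≟Q quad a′ b′ c′ =
  map′ (λ (p , q , r) → cong₃ quad p q r) (λ { refl → refl , refl , refl })
       (a ≟ a′ ×-dec b ≟ b′ ×-dec c ≟ c′)

valueAt-+Q : ∀ k p q → valueAt k (p +Q q) ≡ valueAt k p + valueAt k q
valueAt-+Q k (quad a b c) (quad a′ b′ c′) =
  solve 8 (λ a b c a′ b′ c′ k t → (a :+ a′) :+ (b :+ b′) :* k :+ (c :+ c′) :* t
                                 := (a :+ b :* k :+ c :* t) :+ (a′ :+ b′ :* k :+ c′ :* t))
        refl a b c a′ b′ c′ k (k C 2)

suc-C2 : ∀ k → suc k C 2 ≡ k + k C 2
suc-C2 k = trans (sym (nCk+nC[k+1]≡[n+1]C[k+1] k 1)) (cong (_+ k C 2) (nC1≡n k))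

valueAt-suc : ∀ k q → valueAt (suc k) q ≡ valueAt k (advance q)
valueAt-suc k (quad a b c) = begin
  a + b * suc k + c * (suc k C 2)      ≡⟨ cong (λ t → a + b * suc k + c * t) (suc-C2 k) ⟩
  a + b * suc k + c * (k + k C 2)      ≡⟨ solve 5 (λ a b c k t → a :+ b :* (con 1 :+ k) :+ c :* (k :+ t)
                                                            := (a :+ b) :+ (b :+ c) :* k :+ c :* t)
                                                  refl a b c k (k C 2) ⟩
  (a + b) + (b + c) * k + c * (k C 2)  ∎

module Q where
  open MinCountOps _+Q_ public
  open Transfer _+Q_ public

instantiate : ℕ → MinCount Quad → MinCount ℕ
instantiate k x = shift (2 * k) (mapCount (valueAt k) x)

advanceᴹ : MinCount Quad → MinCount Quad
advanceᴹ ∞          = ∞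
advanceᴹ (best o q) = best (2 + o) (advance q)

instantiate-suc : ∀ k x → instantiate (suc k) x ≡ instantiate k (advanceᴹ x)
instantiate-suc k ∞          = refl
instantiate-suc k (best o q) = cong₂ best
  (solve 2 (λ k o → con 2 :* (con 1 :+ k) :+ o := con 2 :* k :+ (con 2 :+ o)) refl k o)
  (valueAt-suc k q)

module _ (k : ℕ) where

  instantiate-⊕ : ∀ x y → instantiate k (x Q.⊕ y) ≡ instantiate k x ⊕ instantiate k y
  instantiate-⊕ x y = trans (cong (shift (2 * k)) (MapCount.mapCount-⊕ (valueAt k) (valueAt-+Q k) x y))
                            (shift-⊕ (2 * k) (mapCount (valueAt k) x) (mapCount (valueAt k) y))

  instantiate-shift : ∀ w x → instantiate k (shift w x) ≡ shift w (instantiate k x)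
  instantiate-shift w ∞          = refl
  instantiate-shift w (best o q) = cong (λ u → best u (valueAt k q)) (x∙yz≈y∙xz (2 * k) w o)

  ⨁-instantiate : {X : Set} (xs : List X) (f : X → MinCount Quad) →
                  instantiate k (BigOp.⨁ Q._⊕_ ∞ xs f) ≡ ⨁[ x ← xs ] instantiate k (f x)
  ⨁-instantiate = BigOpHomomorphism.⨁-hom {_◦_ = _⊕_} (instantiate k) refl instantiate-⊕

  instantiate-step : ∀ V x y → instantiate k (Q.step V x y) ≡ step (λ u v → instantiate k (V u v)) x y
  instantiate-step V x y = begin
    instantiate k (Q.step V x y)
      ≡⟨ ⨁-instantiate rungs (λ z → if rungDominated x y z then shift (weight z) (V y z) else ∞) ⟩
    ⨁[ z ← rungs ] instantiate k (if rungDominated x y z then shift (weight z) (V y z) else ∞)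
      ≡⟨ ⨁-cong rungs (λ z → commute (rungDominated x y z) z) ⟩
    step (λ u v → instantiate k (V u v)) x y ∎
    where
    commute : ∀ d z → instantiate k (if d then shift (weight z) (V y z) else ∞)
                      ≡ (if d then shift (weight z) (instantiate k (V y z)) else ∞)
    commute true  z = instantiate-shift (weight z) (V y z)
    commute false z = refl

  instantiate-cycleTotal : ∀ D → instantiate k (Q.cycleTotal D) ≡ cycleTotal (λ a b → instantiate k (D a b))
  instantiate-cycleTotal D = begin
    instantiate k (Q.cycleTotal D)
      ≡⟨ ⨁-instantiate rungs (λ a → BigOp.⨁ Q._⊕_ ∞ rungs (λ b → shift (weight a + weight b) (D a b))) ⟩
    ⨁[ a ← rungs ] instantiate k (BigOp.⨁ Q._⊕_ ∞ rungs (λ b → shift (weight a + weight b) (D a b)))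
      ≡⟨ ⨁-cong rungs (λ a → trans (⨁-instantiate rungs (λ b → shift (weight a + weight b) (D a b)))
                                   (⨁-cong rungs (λ b → instantiate-shift (weight a + weight b) (D a b)))) ⟩
    cycleTotal (λ a b → instantiate k (D a b)) ∎

-- The candidate for the table at stage 11 + 4k: the polynomial through its values at k = 0, 1, 2.
-- Nothing depends on this being an interpolation; symbolicTable-start and symbolicTable-period check it.
fit : MinCount ℕ → MinCount ℕ → MinCount ℕ → MinCount Quad
fit (best w v₀) (best _ v₁) (best _ v₂) = best w (quad v₀ (v₁ ∸ v₀) (v₂ ∸ v₁ ∸ (v₁ ∸ v₀)))
fit _           _           _           = ∞

fitTables : Table (MinCount ℕ) → Table (MinCount ℕ) → Table (MinCount ℕ) → Table (MinCount Quad)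
fitTables T₀ T₁ T₂ = tabulate₂ (λ x y → fit (lookup₂ T₀ x y) (lookup₂ T₁ x y) (lookup₂ T₂ x y))

symbolicTable : Rung → Rung → Table (MinCount Quad)
symbolicTable a b = fromStage (iterate 11 (boundary a b))
  where
  fromNext : Table (MinCount ℕ) → Table (MinCount ℕ) → Table (MinCount Quad)
  fromNext T₀ T₁ = fitTables T₀ T₁ (iterate 4 T₁)
  fromStage : Table (MinCount ℕ) → Table (MinCount Quad)
  fromStage T = fromNext T (iterate 4 T)

symbolicTable-start : ∀ a b x y →
  lookup₂ (iterate 11 (boundary a b)) x y ≡ instantiate 0 (lookup₂ (symbolicTable a b) x y)
symbolicTable-start a b x y =
  trans (cong (λ T → lookup₂ T x y) (tabulate₂-injective numeric symbolic agree a b))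
        (lookup₂-mapTable (instantiate 0) (symbolicTable a b) x y)
  where
  numeric symbolic : Rung → Rung → Table (MinCount ℕ)
  numeric  a b = iterate 11 (boundary a b)
  symbolic a b = mapTable (instantiate 0) (symbolicTable a b)
  agree : tabulate₂ numeric ≡ tabulate₂ symbolic
  agree = from-yes (≟-Table (≟-Table (≟-MinCount _≟_)) (tabulate₂ numeric) (tabulate₂ symbolic))

symbolicTable-period : ∀ a b x y →
  lookup₂ (Q.iterate 4 (symbolicTable a b)) x y ≡ advanceᴹ (lookup₂ (symbolicTable a b) x y)
symbolicTable-period a b x y =
  trans (cong (λ T → lookup₂ T x y) (tabulate₂-injective later advanced agree a b))
        (lookup₂-mapTable advanceᴹ (symbolicTable a b) x y)
  where
  later advanced : Rung → Rung → Table (MinCount Quad)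
  later    a b = Q.iterate 4 (symbolicTable a b)
  advanced a b = mapTable advanceᴹ (symbolicTable a b)
  agree : tabulate₂ later ≡ tabulate₂ advanced
  agree = from-yes (≟-Table (≟-Table (≟-MinCount _≟Q_)) (tabulate₂ later) (tabulate₂ advanced))

-- Recursive rather than 11 + 4 * k, so that iterate (stage (suc k)) unfolds to four steps after
-- iterate (stage k); an arithmetic equation under iterate would make the checker normalise whole tables.
stage : ℕ → ℕ
stage zero    = 11
stage (suc k) = 4 + stage k

stage≡ : ∀ k → stage k ≡ 11 + 4 * k
stage≡ zero    = refl
stage≡ (suc k) = trans (cong (4 +_) (stage≡ k))
                       (solve 1 (λ k → con 4 :+ (con 11 :+ con 4 :* k) := con 11 :+ con 4 :* (con 1 :+ k)) refl k)

module _ (k : ℕ) (start : ∀ a b x y → lookup₂ (iterate (stage k) (boundary a b)) x y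
                                      ≡ instantiate k (lookup₂ (symbolicTable a b) x y)) where

  iterate-instantiate : ∀ r a b x y → lookup₂ (iterate (r + stage k) (boundary a b)) x y
                                      ≡ instantiate k (lookup₂ (Q.iterate r (symbolicTable a b)) x y)
  iterate-instantiate zero    = start
  iterate-instantiate (suc r) a b x y = begin
    lookup₂ (iterate (suc r + stage k) (boundary a b)) x y
      ≡⟨ lookup₂-iterate (r + stage k) (boundary a b) x y ⟩
    step (lookup₂ (iterate (r + stage k) (boundary a b))) x y
      ≡⟨ step-cong (iterate-instantiate r a b) x y ⟩
    step (λ u v → instantiate k (lookup₂ (Q.iterate r (symbolicTable a b)) u v)) x y
      ≡⟨ instantiate-step k (lookup₂ (Q.iterate r (symbolicTable a b))) x y ⟨
    instantiate k (Q.step (lookup₂ (Q.iterate r (symbolicTable a b))) x y)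
      ≡⟨ cong (instantiate k) (Q.lookup₂-iterate r (symbolicTable a b) x y) ⟨
    instantiate k (lookup₂ (Q.iterate (suc r) (symbolicTable a b)) x y) ∎

iterate-periodic : ∀ k a b x y → lookup₂ (iterate (stage k) (boundary a b)) x y
                                 ≡ instantiate k (lookup₂ (symbolicTable a b) x y)
iterate-periodic zero          = symbolicTable-start
iterate-periodic (suc k) a b x y = begin
  lookup₂ (iterate (4 + stage k) (boundary a b)) x y
    ≡⟨ iterate-instantiate k (iterate-periodic k) 4 a b x y ⟩
  instantiate k (lookup₂ (Q.iterate 4 (symbolicTable a b)) x y)
    ≡⟨ cong (instantiate k) (symbolicTable-period a b x y) ⟩
  instantiate k (advanceᴹ (lookup₂ (symbolicTable a b) x y))
    ≡⟨ instantiate-suc k (lookup₂ (symbolicTable a b) x y) ⟨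
  instantiate (suc k) (lookup₂ (symbolicTable a b) x y) ∎

periodicTally : ℕ → MinCount Quad
periodicTally r = Q.cycleTotal (λ a b → lookup₂ (Q.iterate r (symbolicTable a b)) a b)

prismTally-periodic : ∀ r k → prismTally (r + stage k) ≡ instantiate k (periodicTally r)
prismTally-periodic r k = begin
  cycleTotal (λ a b → lookup₂ (iterate (r + stage k) (boundary a b)) a b)
    ≡⟨ ⨁-cong rungs (λ a → ⨁-cong rungs (λ b →
         cong (shift (weight a + weight b)) (iterate-instantiate k (iterate-periodic k) r a b a b))) ⟩
  cycleTotal (λ a b → instantiate k (lookup₂ (Q.iterate r (symbolicTable a b)) a b))
    ≡⟨ instantiate-cycleTotal k (λ a b → lookup₂ (Q.iterate r (symbolicTable a b)) a b) ⟨
  instantiate k (periodicTally r) ∎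

periodicTally-0 : periodicTally 0 ≡ best 7 (quad 26 8 0)
periodicTally-0 = from-yes (≟-MinCount _≟Q_ (periodicTally 0) (best 7 (quad 26 8 0)))

periodicTally-1 : periodicTally 1 ≡ best 8 (quad 224 136 32)
periodicTally-1 = from-yes (≟-MinCount _≟Q_ (periodicTally 1) (best 8 (quad 224 136 32)))

periodicTally-2 : periodicTally 2 ≡ best 8 (quad 30 8 0)
periodicTally-2 = from-yes (≟-MinCount _≟Q_ (periodicTally 2) (best 8 (quad 30 8 0)))

periodicTally-3 : periodicTally 3 ≡ best 8 (quad 4 0 0)
periodicTally-3 = from-yes (≟-MinCount _≟Q_ (periodicTally 3) (best 8 (quad 4 0 0)))

-- The dominion

twice-C2 : ∀ k → k C 2 + k C 2 + k ≡ k * k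
twice-C2 zero    = refl
twice-C2 (suc k) = begin
  suc k C 2 + suc k C 2 + suc k      ≡⟨ cong (λ t → t + t + suc k) (suc-C2 k) ⟩
  (k + k C 2) + (k + k C 2) + suc k  ≡⟨ solve 2 (λ k t → (k :+ t) :+ (k :+ t) :+ (con 1 :+ k)
                                                     := (t :+ t :+ k) :+ (con 1 :+ k :+ k)) refl k (k C 2) ⟩
  (k C 2 + k C 2 + k) + (1 + k + k)  ≡⟨ cong (_+ (1 + k + k)) (twice-C2 k) ⟩
  k * k + (1 + k + k)                ≡⟨ solve 1 (λ k → k :* k :+ (con 1 :+ k :+ k) := (con 1 :+ k) :* (con 1 :+ k)) refl k ⟩
  suc k * suc k                      ∎

valueAt-linear : ∀ c k → valueAt k (quad (2 * c) 8 0) ≡ 2 * (c + 4 * k)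
valueAt-linear c k =
  solve 3 (λ c k t → con 2 :* c :+ con 8 :* k :+ con 0 :* t := con 2 :* (c :+ con 4 :* k)) refl c k (k C 2)

valueAt-quadratic : ∀ k → valueAt k (quad 224 136 32) ≡ (14 + 4 * k) * (14 + 4 * k + 2)
valueAt-quadratic k = begin
  224 + 136 * k + 32 * (k C 2)              ≡⟨ solve 2 (λ k t → con 224 :+ con 136 :* k :+ con 32 :* t
                                                            := con 224 :+ con 120 :* k :+ con 16 :* (t :+ t :+ k))
                                                        refl k (k C 2) ⟩
  224 + 120 * k + 16 * (k C 2 + k C 2 + k)  ≡⟨ cong (λ t → 224 + 120 * k + 16 * t) (twice-C2 k) ⟩
  224 + 120 * k + 16 * (k * k)              ≡⟨ solve 1 (λ k → con 224 :+ con 120 :* k :+ con 16 :* (k :* k)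
                                                            := (con 14 :+ con 4 :* k) :* (con 14 :+ con 4 :* k :+ con 2))
                                                        refl k ⟩
  (14 + 4 * k) * (14 + 4 * k + 2)           ∎

periods : ∀ b t k → b + 4 * (t + k) ≡ b + 4 * t + 4 * k
periods = solve 3 (λ b t k → b :+ con 4 :* (t :+ k) := b :+ con 4 :* t :+ con 4 :* k) refl

mod4-offset : ∀ n b → n % 4 ≡ b % 4 → b ≤ n + 3 → ∃[ k ] n ≡ b + 4 * k
mod4-offset n b same b≤n+3 = q ∸ p , (begin
  n                            ≡⟨ n≡ ⟩
  b % 4 + q * 4                ≡⟨ cong (λ t → b % 4 + t * 4) (m+[n∸m]≡n p≤q) ⟨
  b % 4 + (p + (q ∸ p)) * 4    ≡⟨ solve 3 (λ r p d → r :+ (p :+ d) :* con 4 := r :+ p :* con 4 :+ con 4 :* d)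
                                          refl (b % 4) p (q ∸ p) ⟩
  b % 4 + p * 4 + 4 * (q ∸ p)  ≡⟨ cong (_+ 4 * (q ∸ p)) (m≡m%n+[m/n]*n b 4) ⟨
  b + 4 * (q ∸ p)              ∎)
  where
  q = n / 4
  p = b / 4
  n≡ : n ≡ b % 4 + q * 4
  n≡ = trans (m≡m%n+[m/n]*n n 4) (cong (_+ q * 4) same)
  n+4≡ : n + 4 ≡ b % 4 + suc q * 4
  n+4≡ = trans (cong (_+ 4) n≡)
               (solve 2 (λ r q → r :+ q :* con 4 :+ con 4 := r :+ (con 1 :+ q) :* con 4) refl (b % 4) q)
  b<n+4 : b < n + 4
  b<n+4 = subst (b <_) (sym (+-suc n 3)) (s≤s b≤n+3)
  p≤q : p ≤ q
  p≤q = ≤-pred (*-cancelʳ-< 4 p (suc q)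
          (+-cancelˡ-< (b % 4) (p * 4) (suc q * 4) (subst₂ _<_ (m≡m%n+[m/n]*n b 4) n+4≡ b<n+4)))

-- ζ is kept applied to a variable n, and only equations between numerals are proved: the checker
-- must never compare ζ at two syntactically different arguments, which would run the brute force.
ζ-from : ∀ m {a c} → prismTally m ≡ best a c → ∀ n → n ≡ 2 + m → ζ n ≡ c
ζ-from m eq n refl = proj₂ (prismTally-γ-ζ m eq)

ζ-periodic : ∀ r k {o q} → periodicTally r ≡ best o q → ∀ n → n ≡ 13 + r + 4 * k → ζ n ≡ valueAt k q
ζ-periodic r k eq n n≡ =
  ζ-from (r + stage k) (trans (prismTally-periodic r k) (cong (instantiate k) eq)) n (begin
    n                          ≡⟨ n≡ ⟩
    13 + r + 4 * k             ≡⟨ solve 2 (λ r k → con 13 :+ r :+ con 4 :* k := con 2 :+ (r :+ (con 11 :+ con 4 :* k)))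
                                           refl r k ⟩
    2 + (r + (11 + 4 * k))     ≡⟨ cong (λ s → 2 + (r + s)) (stage≡ k) ⟨
    2 + (r + stage k)          ∎)

ζ-4k : ∀ n k → n ≡ 4 + 4 * k → ζ n ≡ 4
ζ-4k n 0                   eq = ζ-from 2 refl n eq
ζ-4k n 1                   eq = ζ-from 6 refl n eq
ζ-4k n 2                   eq = ζ-from 10 refl n eq
ζ-4k n (suc (suc (suc k))) eq = ζ-periodic 3 k periodicTally-3 n (trans eq (periods 4 3 k))

ζ-4k+1 : ∀ n k → n ≡ 5 + 4 * k → ζ n ≡ 2 * n
ζ-4k+1 n 0             eq = trans (ζ-from 3 refl n eq) (cong (2 *_) (sym eq))
ζ-4k+1 n 1             eq = trans (ζ-from 7 refl n eq) (cong (2 *_) (sym eq))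
ζ-4k+1 n (suc (suc k)) eq = begin
  ζ n                      ≡⟨ ζ-periodic 0 k periodicTally-0 n n≡ ⟩
  valueAt k (quad 26 8 0)  ≡⟨ valueAt-linear 13 k ⟩
  2 * (13 + 4 * k)         ≡⟨ cong (2 *_) n≡ ⟨
  2 * n                    ∎
  where n≡ = trans eq (periods 5 2 k)

ζ-4k+2 : ∀ n k → n ≡ 10 + 4 * k → ζ n ≡ n * (n + 2)
ζ-4k+2 n 0       eq = trans (ζ-from 8 refl n eq) (cong (λ m → m * (m + 2)) (sym eq))
ζ-4k+2 n (suc k) eq = begin
  ζ n                              ≡⟨ ζ-periodic 1 k periodicTally-1 n n≡ ⟩
  valueAt k (quad 224 136 32)      ≡⟨ valueAt-quadratic k ⟩
  (14 + 4 * k) * (14 + 4 * k + 2)  ≡⟨ cong (λ m → m * (m + 2)) n≡ ⟨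
  n * (n + 2)                      ∎
  where n≡ = trans eq (periods 10 1 k)

ζ-4k+3 : ∀ n k → n ≡ 7 + 4 * k → ζ n ≡ 2 * n
ζ-4k+3 n 0             eq = trans (ζ-from 5 refl n eq) (cong (2 *_) (sym eq))
ζ-4k+3 n 1             eq = trans (ζ-from 9 refl n eq) (cong (2 *_) (sym eq))
ζ-4k+3 n (suc (suc k)) eq = begin
  ζ n                      ≡⟨ ζ-periodic 2 k periodicTally-2 n n≡ ⟩
  valueAt k (quad 30 8 0)  ≡⟨ valueAt-linear 15 k ⟩
  2 * (15 + 4 * k)         ≡⟨ cong (2 *_) n≡ ⟨
  2 * n                    ∎
  where n≡ = trans eq (periods 7 2 k)

theorem3p1 : (n : ℕ) → 3 ≤ n →
    (n ≡ 3 → ζ n ≡ 9) ×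
    (n % 4 ≡ 0 → ζ n ≡ 4) ×
    (n % 4 ≡ 1 → ζ n ≡ 2 * n) ×
    (n % 4 ≡ 3 → 7 ≤ n → ζ n ≡ 2 * n) ×
    (n ≡ 6 → ζ n ≡ 51) ×
    (n % 4 ≡ 2 → 10 ≤ n → ζ n ≡ n * (n + 2))
theorem3p1 n 3≤n =
    (λ n≡3 → ζ-from 1 refl n n≡3)
  , (λ n%4≡0 → uncurry (ζ-4k n) (mod4-offset n 4 n%4≡0 (+-monoˡ-≤ 3 1≤n)))
  , (λ n%4≡1 → uncurry (ζ-4k+1 n) (mod4-offset n 5 n%4≡1 (+-monoˡ-≤ 3 2≤n)))
  , (λ n%4≡3 7≤n → uncurry (ζ-4k+3 n) (mod4-offset n 7 n%4≡3 (≤-trans 7≤n (m≤m+n n 3))))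
  , (λ n≡6 → ζ-from 4 refl n n≡6)
  , (λ n%4≡2 10≤n → uncurry (ζ-4k+2 n) (mod4-offset n 10 n%4≡2 (≤-trans 10≤n (m≤m+n n 3))))
  where
  2≤n = ≤-trans (s≤s (s≤s z≤n)) 3≤n
  1≤n = ≤-trans (s≤s z≤n) 2≤n
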